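{- Let $n\ge 0$ and let $\lambda$ be a partition with at most $2n$ parts, written $\lambda=(\lambda_1,\dots,\lambda_{2n})$ (padding with zeros). Let $\lambda+\delta$ denote the partition $(\lambda_1+2n-1,\lambda_2+2n-2,\dots,\lambda_{2n-1}+1,\lambda_{2n})$, identified with its Young diagram. Then \[ b(\lambda)=\sum_{(i,j)\in\lambda+\delta}(-1)^{\lambda_i-i-j+1}(\lambda_i-i)- \sum_{1\leq i<j\leq 2n}(-1)^{\lambda_i-\lambda_j+j-i}(\lambda_i-i). \] Moreover, if $\lambda$ has empty $2$-core, then \[ b(\lambda')= \frac{|\lambda|}{2}-n^2-n+\sum_{1\leq i<j\leq 2n} (-1)^{\lambda_i-\lambda_j+j-i}(\lambda_j-j). \]
   Context: A partition $\lambda$ is identified with its Young diagram $\{(i,j):1\le j\le\lambda_i\}$; $\lambda'$ is its conjugate and $|\lambda|=\sum_i\lambda_i$. A partition has empty $2$-core if its Young diagram can be tiled by dominoes. The statistic $b$ is \[ b(\lambda):=\sum_{(i,j)\in\lambda}(-1)^{\lambda_i+\lambda_j'-i-j+1}(\lambda_i-i). \] -}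

module Defs where

open import Data.Nat as ℕ using (ℕ; zero; suc; _≤_; _<_; _≤?_; _∸_; _%_)
open import Data.Integer as ℤ using (ℤ; +_; _+_; _-_; _*_; ∣_∣)
open import Data.List using (List; []; _∷_; map; length; filter; concatMap; foldr; upTo)
open import Data.Nat.ListAction using (sum)
open import Data.List.Relation.Unary.All using (All)
open import Data.List.Relation.Unary.Linked using (Linked)
open import Data.List.Relation.Binary.Permutation.Propositional using (_↭_)
open import Data.Product using (_×_; _,_; ∃)
open import Data.Bool using (Bool; true; false)

-- the list [a, a+1, ..., b]  (empty if b < a)
range : ℕ → ℕ → List ℕ
range a b = map (λ k → a ℕ.+ k) (upTo (suc b ∸ a))

sumℤ : List ℤ → ℤ
sumℤ = foldr _+_ (+ 0)

Σ[_⋯_] : ℕ → ℕ → (ℕ → ℤ) → ℤ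
Σ[ a ⋯ b ] f = sumℤ (map f (range a b))

-- (-1)^k for an integer k
sgn : ℤ → ℤ
sgn k with ∣ k ∣ % 2
... | zero = + 1
... | suc _ = ℤ.- (+ 1)

IsPartition : List ℕ → Set
IsPartition λ' = Linked ℕ._≥_ λ' × All (0 <_) λ'

-- λ_i (1-indexed), zero beyond the last part
part : List ℕ → ℕ → ℕ
part []       _             = 0
part (x ∷ xs) zero          = 0
part (x ∷ xs) (suc zero)    = x
part (x ∷ xs) (suc (suc i)) = part xs (suc i)

size : List ℕ → ℕ
size = sum

conj : List ℕ → List ℕ
conj μ = map (λ j → length (filter (j ≤?_) μ)) (range 1 (part μ 1))

cells : List ℕ → List (ℕ × ℕ)
cells μ = concatMap (λ i → map (λ j → (i , j)) (range 1 (part μ i))) (range 1 (length μ))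

-- dominoes: a cell plus orientation (true = horizontal, false = vertical)
Domino : Set
Domino = (ℕ × ℕ) × Bool

dominoCells : Domino → List (ℕ × ℕ)
dominoCells ((i , j) , true)  = (i , j) ∷ (i , suc j) ∷ []
dominoCells ((i , j) , false) = (i , j) ∷ (suc i , j) ∷ []

-- empty 2-core: the Young diagram can be tiled by dominoes
EmptyTwoCore : List ℕ → Set
EmptyTwoCore μ = ∃ λ (D : List Domino) → concatMap dominoCells D ↭ cells μ

b : List ℕ → ℤ
b μ = Σ[ 1 ⋯ length μ ] (λ i → Σ[ 1 ⋯ part μ i ] (λ j →
        sgn (+ part μ i + + part (conj μ) j - + i - + j + + 1) * (+ part μ i - + i)))

{-# OPTIONS --safe #-}
module Submission where

-- Write ε k = (−1)^k. The sign in b is (−1) to the hook length of the cell (i, j), that is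
-- −ε(λᵢ − i) ε(λ′ⱼ − j). In row i the columns j with λ′ⱼ = k form the block λₖ₊₁ < j ≤ λₖ
-- (i ≤ k ≤ 2n), and over such a block the alternating sums of ε j and of ε j (k − j)
-- telescope to boundary terms in λₖ and λₖ₊₁. Summing over the blocks turns each row sum
-- of b(λ) into the first formula. For b(λ′) we use λ″ = λ and the duality λ′ᵣ ≥ s ⇔ λₛ ≥ r
-- to sum over the rows of λ instead; what is left is controlled by Σᵢ ε(λᵢ − i), which
-- vanishes when λ is tiled by dominoes (each domino has total checkerboard weight ε i ε j zero),
-- and by its square, which is 2n + 2 Σ_{i<k} ε(λᵢ − i) ε(λₖ − k).

open import Data.Nat as ℕ using (ℕ; zero; suc; _≤_; _<_; _≥_; _∸_; _%_; z≤n; s≤s; _≤?_; _<?_; ⌊_/2⌋)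
import Data.Nat.Properties as ℕ
open import Data.Integer as ℤ using (ℤ; +_; -[1+_]; _+_; _-_; _*_; -_; ∣_∣)
import Data.Integer.Properties as ℤ
open import Data.Integer.Tactic.RingSolver using (solve-∀)
open import Data.List using (List; []; _∷_; map; length; filter; applyUpTo; _++_; concatMap)
import Data.List.Properties as List
open import Data.List.Relation.Unary.Linked as Linked using (Linked)
open import Data.List.Relation.Binary.Permutation.Propositional using (_↭_; ↭⇒↭ₛ)
import Data.List.Relation.Binary.Permutation.Propositional.Properties as Perm
import Data.List.Relation.Binary.Permutation.Setoid.Properties as PermSetoid
open import Data.Product using (_×_; _,_; proj₁; proj₂)
open import Data.Sum using (inj₁; inj₂)
open import Data.Bool using (true; false)
open import Function using (_∘_)
open import Relation.Nullary using (Dec; yes; no; contradiction)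
open import Relation.Binary.PropositionalEquality
open ≡-Reasoning

open import Defs

-- Finite sums

∑ : ℕ → ℕ → (ℕ → ℤ) → ℤ
∑ a zero    f = + 0
∑ a (suc m) f = f a + ∑ (suc a) m f

∑-cong : ∀ a m {f g : ℕ → ℤ} → (∀ k → a ≤ k → k < a ℕ.+ m → f k ≡ g k) → ∑ a m f ≡ ∑ a m g
∑-cong a zero    eq = refl
∑-cong a (suc m) eq = cong₂ _+_ (eq a ℕ.≤-refl (ℕ.m<m+n a (s≤s z≤n)))
  (∑-cong (suc a) m λ k a<k k<a+1+m → eq k (ℕ.<⇒≤ a<k) (subst (k <_) (sym (ℕ.+-suc a m)) k<a+1+m))

∑-cong′ : ∀ a m {f g : ℕ → ℤ} → (∀ k → f k ≡ g k) → ∑ a m f ≡ ∑ a m g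
∑-cong′ a m eq = ∑-cong a m λ k _ _ → eq k

∑-zero : ∀ a m {f : ℕ → ℤ} → (∀ k → a ≤ k → k < a ℕ.+ m → f k ≡ + 0) → ∑ a m f ≡ + 0
∑-zero a m eq = trans (∑-cong a m eq) (zeros a m)
  where
  zeros : ∀ a m → ∑ a m (λ _ → + 0) ≡ + 0
  zeros a zero    = refl
  zeros a (suc m) = trans (ℤ.+-identityˡ _) (zeros (suc a) m)

∑-one : ∀ a m → ∑ a m (λ _ → + 1) ≡ + m
∑-one a zero    = refl
∑-one a (suc m) = cong (_+_ (+ 1)) (∑-one (suc a) m)

∑-+ : ∀ a m (f g : ℕ → ℤ) → ∑ a m (λ k → f k + g k) ≡ ∑ a m f + ∑ a m g
∑-+ a zero    f g = refl
∑-+ a (suc m) f g = begin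
  (f a + g a) + ∑ (suc a) m (λ k → f k + g k) ≡⟨ cong (_+_ (f a + g a)) (∑-+ (suc a) m f g) ⟩
  (f a + g a) + (∑ (suc a) m f + ∑ (suc a) m g) ≡⟨ interchange (f a) (g a) _ _ ⟩
  (f a + ∑ (suc a) m f) + (g a + ∑ (suc a) m g) ∎
  where
  interchange : ∀ x y z w → (x + y) + (z + w) ≡ (x + z) + (y + w)
  interchange = solve-∀

∑-*ˡ : ∀ a m x (f : ℕ → ℤ) → ∑ a m (λ k → x * f k) ≡ x * ∑ a m f
∑-*ˡ a zero    x f = sym (ℤ.*-zeroʳ x)
∑-*ˡ a (suc m) x f = trans (cong (_+_ (x * f a)) (∑-*ˡ (suc a) m x f)) (sym (ℤ.*-distribˡ-+ x (f a) _))

∑-*ʳ : ∀ a m x (f : ℕ → ℤ) → ∑ a m (λ k → f k * x) ≡ ∑ a m f * x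
∑-*ʳ a m x f = begin
  ∑ a m (λ k → f k * x) ≡⟨ ∑-cong′ a m (λ k → ℤ.*-comm (f k) x) ⟩
  ∑ a m (λ k → x * f k) ≡⟨ ∑-*ˡ a m x f ⟩
  x * ∑ a m f           ≡⟨ ℤ.*-comm x _ ⟩
  ∑ a m f * x           ∎

∑-neg : ∀ a m (f : ℕ → ℤ) → ∑ a m (λ k → - f k) ≡ - ∑ a m f
∑-neg a m f = begin
  ∑ a m (λ k → - f k)        ≡⟨ ∑-cong′ a m (λ k → sym (ℤ.-1*i≡-i (f k))) ⟩
  ∑ a m (λ k → - + 1 * f k)  ≡⟨ ∑-*ˡ a m (- + 1) f ⟩
  - + 1 * ∑ a m f            ≡⟨ ℤ.-1*i≡-i _ ⟩
  - ∑ a m f                  ∎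

∑-- : ∀ a m (f g : ℕ → ℤ) → ∑ a m (λ k → f k - g k) ≡ ∑ a m f - ∑ a m g
∑-- a m f g = trans (∑-+ a m f (λ k → - g k)) (cong (_+_ (∑ a m f)) (∑-neg a m g))

∑-++ : ∀ a m p (f : ℕ → ℤ) → ∑ a (m ℕ.+ p) f ≡ ∑ a m f + ∑ (a ℕ.+ m) p f
∑-++ a zero    p f = trans (cong (λ x → ∑ x p f) (sym (ℕ.+-identityʳ a))) (sym (ℤ.+-identityˡ _))
∑-++ a (suc m) p f = begin
  f a + ∑ (suc a) (m ℕ.+ p) f                  ≡⟨ cong (_+_ (f a)) (∑-++ (suc a) m p f) ⟩
  f a + (∑ (suc a) m f + ∑ (suc a ℕ.+ m) p f)  ≡⟨ sym (ℤ.+-assoc (f a) _ _) ⟩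
  (f a + ∑ (suc a) m f) + ∑ (suc a ℕ.+ m) p f  ≡⟨ cong (λ x → (f a + ∑ (suc a) m f) + ∑ x p f) (sym (ℕ.+-suc a m)) ⟩
  (f a + ∑ (suc a) m f) + ∑ (a ℕ.+ suc m) p f  ∎

∑-snoc : ∀ a m (f : ℕ → ℤ) → ∑ a (suc m) f ≡ ∑ a m f + f (a ℕ.+ m)
∑-snoc a m f = begin
  ∑ a (suc m) f                ≡⟨ cong (λ x → ∑ a x f) (ℕ.+-comm 1 m) ⟩
  ∑ a (m ℕ.+ 1) f              ≡⟨ ∑-++ a m 1 f ⟩
  ∑ a m f + (f (a ℕ.+ m) + + 0) ≡⟨ cong (_+_ (∑ a m f)) (ℤ.+-identityʳ _) ⟩
  ∑ a m f + f (a ℕ.+ m)        ∎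

∑-extend : ∀ a m M (f : ℕ → ℤ) → m ≤ M → (∀ k → a ℕ.+ m ≤ k → f k ≡ + 0) → ∑ a m f ≡ ∑ a M f
∑-extend a m M f m≤M vanish = begin
  ∑ a m f                                ≡⟨ sym (ℤ.+-identityʳ _) ⟩
  ∑ a m f + + 0                          ≡⟨ cong (_+_ (∑ a m f)) (sym (∑-zero (a ℕ.+ m) (M ∸ m) λ k p _ → vanish k p)) ⟩
  ∑ a m f + ∑ (a ℕ.+ m) (M ∸ m) f        ≡⟨ sym (∑-++ a m (M ∸ m) f) ⟩
  ∑ a (m ℕ.+ (M ∸ m)) f                  ≡⟨ cong (λ x → ∑ a x f) (ℕ.m+[n∸m]≡n m≤M) ⟩
  ∑ a M f                                ∎

∑-shift : ∀ a m (f : ℕ → ℤ) → ∑ a m (f ∘ suc) ≡ ∑ (suc a) m f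
∑-shift a zero    f = refl
∑-shift a (suc m) f = cong (_+_ (f (suc a))) (∑-shift (suc a) m f)

∑-translate : ∀ a b m (f : ℕ → ℤ) → ∑ b m (λ k → f (a ℕ.+ k)) ≡ ∑ (a ℕ.+ b) m f
∑-translate a b zero    f = refl
∑-translate a b (suc m) f = cong (_+_ (f (a ℕ.+ b)))
  (trans (∑-translate a (suc b) m f) (cong (λ x → ∑ x m f) (ℕ.+-suc a b)))

∑-telescope : ∀ a m (G : ℕ → ℤ) → ∑ a m (λ k → G (suc k) - G k) ≡ G (a ℕ.+ m) - G a
∑-telescope a zero    G = trans (sym (ℤ.+-inverseʳ (G a))) (cong (λ x → G x - G a) (sym (ℕ.+-identityʳ a)))
∑-telescope a (suc m) G = begin
  (G (suc a) - G a) + ∑ (suc a) m (λ k → G (suc k) - G k) ≡⟨ cong (_+_ (G (suc a) - G a)) (∑-telescope (suc a) m G) ⟩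
  (G (suc a) - G a) + (G (suc a ℕ.+ m) - G (suc a))       ≡⟨ cancel (G (suc a)) (G a) (G (suc a ℕ.+ m)) ⟩
  G (suc a ℕ.+ m) - G a                                   ≡⟨ cong (λ x → G x - G a) (sym (ℕ.+-suc a m)) ⟩
  G (a ℕ.+ suc m) - G a                                   ∎
  where
  cancel : ∀ x y z → (x - y) + (z - x) ≡ z - y
  cancel = solve-∀

∑-comm : ∀ a m b p (f : ℕ → ℕ → ℤ) → ∑ a m (λ i → ∑ b p (f i)) ≡ ∑ b p (λ j → ∑ a m (λ i → f i j))
∑-comm a zero    b p f = sym (∑-zero b p λ _ _ _ → refl)
∑-comm a (suc m) b p f = begin
  ∑ b p (f a) + ∑ (suc a) m (λ i → ∑ b p (f i))             ≡⟨ cong (_+_ (∑ b p (f a))) (∑-comm (suc a) m b p f) ⟩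
  ∑ b p (f a) + ∑ b p (λ j → ∑ (suc a) m (λ i → f i j))     ≡⟨ sym (∑-+ b p _ _) ⟩
  ∑ b p (λ j → f a j + ∑ (suc a) m (λ i → f i j))           ∎

when : {P : Set} → Dec P → ℤ → ℤ
when (yes _) x = x
when (no _)  x = + 0

when-cong : ∀ {P Q : Set} (p : Dec P) (q : Dec Q) x → (P → Q) → (Q → P) → when p x ≡ when q x
when-cong (yes _) (yes _) x _   _   = refl
when-cong (yes p) (no ¬q) x P⇒Q _   = contradiction (P⇒Q p) ¬q
when-cong (no ¬p) (yes q) x _   Q⇒P = contradiction (Q⇒P q) ¬p
when-cong (no _)  (no _)  x _   _   = refl

∑-restrict : ∀ a m M (f : ℕ → ℤ) → m ≤ M → ∑ a m f ≡ ∑ a M (λ k → when (k <? a ℕ.+ m) (f k))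
∑-restrict a m M f m≤M =
  trans (∑-cong a m λ k _ → inside k) (∑-extend a m M _ m≤M outside)
  where
  inside : ∀ k → k < a ℕ.+ m → f k ≡ when (k <? a ℕ.+ m) (f k)
  inside k k< with k <? a ℕ.+ m
  ... | yes _   = refl
  ... | no  k≮ = contradiction k< k≮
  outside : ∀ k → a ℕ.+ m ≤ k → when (k <? a ℕ.+ m) (f k) ≡ + 0
  outside k ≤k with k <? a ℕ.+ m
  ... | yes k< = contradiction k< (ℕ.≤⇒≯ ≤k)
  ... | no  _  = refl

∑-triangle-swap : ∀ L N (c l : ℕ → ℕ) (f : ℕ → ℕ → ℤ) →
  (∀ r → 1 ≤ r → r ≤ L → c r ≤ N) → (∀ s → 1 ≤ s → s ≤ N → l s ≤ L) →
  (∀ {r s} → 1 ≤ r → 1 ≤ s → (s ≤ c r → r ≤ l s) × (r ≤ l s → s ≤ c r)) →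
  ∑ 1 L (λ r → ∑ 1 (c r) (f r)) ≡ ∑ 1 N (λ s → ∑ 1 (l s) (λ r → f r s))
∑-triangle-swap L N c l f c≤N l≤L dual = begin
  ∑ 1 L (λ r → ∑ 1 (c r) (f r))
    ≡⟨ ∑-cong 1 L (λ r 1≤r r≤L → ∑-restrict 1 (c r) N (f r) (c≤N r 1≤r (ℕ.≤-pred r≤L))) ⟩
  ∑ 1 L (λ r → ∑ 1 N (λ s → when (s <? suc (c r)) (f r s)))
    ≡⟨ ∑-cong 1 L (λ r 1≤r r≤L → ∑-cong 1 N λ s 1≤s s≤N →
         let s≤c⇔r≤l = dual 1≤r 1≤s in
         when-cong (s <? suc (c r)) (r <? suc (l s)) (f r s)
           (ℕ.s≤s ∘ proj₁ s≤c⇔r≤l ∘ ℕ.≤-pred) (ℕ.s≤s ∘ proj₂ s≤c⇔r≤l ∘ ℕ.≤-pred)) ⟩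
  ∑ 1 L (λ r → ∑ 1 N (λ s → when (r <? suc (l s)) (f r s)))
    ≡⟨ ∑-comm 1 L 1 N _ ⟩
  ∑ 1 N (λ s → ∑ 1 L (λ r → when (r <? suc (l s)) (f r s)))
    ≡⟨ sym (∑-cong 1 N λ s 1≤s s≤N → ∑-restrict 1 (l s) L (λ r → f r s) (l≤L s 1≤s (ℕ.≤-pred s≤N))) ⟩
  ∑ 1 N (λ s → ∑ 1 (l s) (λ r → f r s)) ∎

∑-square : ∀ a m E (x : ℕ → ℤ) → a ℕ.+ m ≡ suc E →
  ∑ a m x * ∑ a m x ≡ ∑ a m (λ i → x i * x i) + + 2 * ∑ a m (λ i → x i * ∑ (suc i) (E ∸ i) x)
∑-square a zero    E x _  = refl
∑-square a (suc m) E x eq = begin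
  (x a + R) * (x a + R)                       ≡⟨ expand (x a) R ⟩
  x a * x a + R * R + + 2 * (x a * R)         ≡⟨ cong₂ (λ y z → x a * x a + y + + 2 * (x a * ∑ (suc a) z x))
                                                   (∑-square (suc a) m E x (trans (sym (ℕ.+-suc a m)) eq)) (sym E∸a≡m) ⟩
  x a * x a + (Q + + 2 * C) + + 2 * (x a * ∑ (suc a) (E ∸ a) x) ≡⟨ regroup (x a * x a) Q C _ ⟩
  (x a * x a + Q) + + 2 * (x a * ∑ (suc a) (E ∸ a) x + C) ∎
  where
  R = ∑ (suc a) m x
  Q = ∑ (suc a) m (λ i → x i * x i)
  C = ∑ (suc a) m (λ i → x i * ∑ (suc i) (E ∸ i) x)
  E∸a≡m : E ∸ a ≡ m
  E∸a≡m = trans (cong (_∸ a) (ℕ.suc-injective (trans (sym eq) (ℕ.+-suc a m)))) (ℕ.m+n∸m≡n a m)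
  expand : ∀ y r → (y + r) * (y + r) ≡ y * y + r * r + + 2 * (y * r)
  expand = solve-∀
  regroup : ∀ p q r t → p + (q + + 2 * r) + + 2 * t ≡ (p + q) + + 2 * (t + r)
  regroup = solve-∀

∑-stagger : ∀ i m (u w : ℕ → ℤ) →
  ∑ i (suc m) (λ k → u k + w (suc k)) ≡ u i + ∑ (suc i) m (λ k → u k + w k) + w (suc (i ℕ.+ m))
∑-stagger i m u w = begin
  ∑ i (suc m) (λ k → u k + w (suc k))                         ≡⟨ ∑-+ i (suc m) u (w ∘ suc) ⟩
  ∑ i (suc m) u + ∑ i (suc m) (w ∘ suc)                       ≡⟨ cong (_+_ (∑ i (suc m) u))
                                                                   (trans (∑-shift i (suc m) w) (∑-snoc (suc i) m w)) ⟩
  (u i + ∑ (suc i) m u) + (∑ (suc i) m w + w (suc i ℕ.+ m))    ≡⟨ regroup (u i) (∑ (suc i) m u) (∑ (suc i) m w) _ ⟩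
  u i + (∑ (suc i) m u + ∑ (suc i) m w) + w (suc (i ℕ.+ m))
    ≡⟨ cong (λ y → u i + y + w (suc (i ℕ.+ m))) (sym (∑-+ (suc i) m u w)) ⟩
  u i + ∑ (suc i) m (λ k → u k + w k) + w (suc (i ℕ.+ m))      ∎
  where
  regroup : ∀ x y z t → (x + y) + (z + t) ≡ x + (y + z) + t
  regroup = solve-∀

sumℤ-applyUpTo : ∀ (f : ℕ → ℤ) (h : ℕ → ℕ) m → sumℤ (map f (applyUpTo h m)) ≡ ∑ 0 m (f ∘ h)
sumℤ-applyUpTo f h zero    = refl
sumℤ-applyUpTo f h (suc m) = cong (_+_ (f (h 0)))
  (trans (sumℤ-applyUpTo f (h ∘ suc) m) (∑-shift 0 m (f ∘ h)))

Σ≡∑ : ∀ a b (f : ℕ → ℤ) → Σ[ a ⋯ b ] f ≡ ∑ a (suc b ∸ a) f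
Σ≡∑ a b f = begin
  sumℤ (map f (map (a ℕ.+_) (applyUpTo (λ k → k) m))) ≡⟨ cong (λ xs → sumℤ (map f xs)) (List.map-applyUpTo (λ k → k) (a ℕ.+_) m) ⟩
  sumℤ (map f (applyUpTo (a ℕ.+_) m))                ≡⟨ sumℤ-applyUpTo f (a ℕ.+_) m ⟩
  ∑ 0 m (λ k → f (a ℕ.+ k))                           ≡⟨ ∑-translate a 0 m f ⟩
  ∑ (a ℕ.+ 0) m f                                     ≡⟨ cong (λ x → ∑ x m f) (ℕ.+-identityʳ a) ⟩
  ∑ a m f                                             ∎
  where
  m = suc b ∸ a

∑-naturals : ∀ n → + 2 * ∑ 1 n (λ i → + i) ≡ + n * (+ n + + 1)
∑-naturals zero    = refl
∑-naturals (suc n) = begin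
  + 2 * ∑ 1 (suc n) (λ i → + i)                       ≡⟨ cong (_*_ (+ 2)) (∑-snoc 1 n (λ i → + i)) ⟩
  + 2 * (∑ 1 n (λ i → + i) + + (1 ℕ.+ n))             ≡⟨ ℤ.*-distribˡ-+ (+ 2) (∑ 1 n (λ i → + i)) (+ (1 ℕ.+ n)) ⟩
  + 2 * ∑ 1 n (λ i → + i) + + 2 * (+ 1 + + n)         ≡⟨ cong (_+ + 2 * (+ 1 + + n)) (∑-naturals n) ⟩
  + n * (+ n + + 1) + + 2 * (+ 1 + + n)               ≡⟨ expand (+ n) ⟩
  (+ 1 + + n) * ((+ 1 + + n) + + 1)                   ∎
  where
  expand : ∀ x → x * (x + + 1) + + 2 * (+ 1 + x) ≡ (+ 1 + x) * ((+ 1 + x) + + 1)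
  expand = solve-∀

-- Signs

ε : ℕ → ℤ
ε zero    = + 1
ε (suc k) = - ε k

εℤ : ℤ → ℤ
εℤ (+ k)     = ε k
εℤ -[1+ k ] = ε (suc k)

signOfParity : ℕ → ℤ
signOfParity zero    = + 1
signOfParity (suc _) = - + 1

sgn≡signOfParity : ∀ k → sgn k ≡ signOfParity (∣ k ∣ % 2)
sgn≡signOfParity k with ∣ k ∣ % 2
... | zero  = refl
... | suc _ = refl

ε≡signOfParity : ∀ n → ε n ≡ signOfParity (n % 2)
ε≡signOfParity zero          = refl
ε≡signOfParity (suc zero)    = refl
ε≡signOfParity (suc (suc n)) = trans (ℤ.neg-involutive (ε n)) (ε≡signOfParity n)

sgn≡εℤ : ∀ k → sgn k ≡ εℤ k
sgn≡εℤ (+ n)     = trans (sgn≡signOfParity (+ n)) (sym (ε≡signOfParity n))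
sgn≡εℤ -[1+ n ] = trans (sgn≡signOfParity -[1+ n ]) (sym (ε≡signOfParity (suc n)))

εℤ-suc : ∀ k → εℤ (ℤ.suc k) ≡ - εℤ k
εℤ-suc (+ n)           = refl
εℤ-suc -[1+ zero ]    = refl
εℤ-suc -[1+ suc n ]   = sym (ℤ.neg-involutive _)

εℤ-pred : ∀ k → εℤ (ℤ.pred k) ≡ - εℤ k
εℤ-pred (+ zero)    = refl
εℤ-pred (+ suc n)   = sym (ℤ.neg-involutive _)
εℤ-pred -[1+ n ]   = refl

εℤ-+ : ∀ x y → εℤ (x + y) ≡ εℤ x * εℤ y
εℤ-+ (+ zero)  y = trans (cong εℤ (ℤ.+-identityˡ y)) (sym (ℤ.*-identityˡ (εℤ y)))
εℤ-+ (+ suc m) y = begin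
  εℤ (+ suc m + y)        ≡⟨ cong εℤ (ℤ.+-assoc (+ 1) (+ m) y) ⟩
  εℤ (ℤ.suc (+ m + y))    ≡⟨ εℤ-suc (+ m + y) ⟩
  - εℤ (+ m + y)          ≡⟨ cong -_ (εℤ-+ (+ m) y) ⟩
  - (ε m * εℤ y)          ≡⟨ ℤ.neg-distribˡ-* (ε m) (εℤ y) ⟩
  - ε m * εℤ y            ∎
εℤ-+ -[1+ zero ]  y = trans (εℤ-pred y) (sym (ℤ.-1*i≡-i (εℤ y)))
εℤ-+ -[1+ suc m ] y = begin
  εℤ (-[1+ suc m ] + y)      ≡⟨ cong εℤ (ℤ.+-assoc -[1+ 0 ] -[1+ m ] y) ⟩
  εℤ (ℤ.pred (-[1+ m ] + y)) ≡⟨ εℤ-pred (-[1+ m ] + y) ⟩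
  - εℤ (-[1+ m ] + y)        ≡⟨ cong -_ (εℤ-+ -[1+ m ] y) ⟩
  - (ε (suc m) * εℤ y)        ≡⟨ ℤ.neg-distribˡ-* (ε (suc m)) (εℤ y) ⟩
  - ε (suc m) * εℤ y          ∎

εℤ-neg : ∀ x → εℤ (- x) ≡ εℤ x
εℤ-neg (+ zero)  = refl
εℤ-neg (+ suc n) = refl
εℤ-neg -[1+ n ] = refl

εℤ-- : ∀ x y → εℤ (x - y) ≡ εℤ x * εℤ y
εℤ-- x y = trans (εℤ-+ x (- y)) (cong (εℤ x *_) (εℤ-neg y))

ε-+ : ∀ m n → ε (m ℕ.+ n) ≡ ε m * ε n
ε-+ m n = εℤ-+ (+ m) (+ n)

ε*ε≡1 : ∀ n → ε n * ε n ≡ + 1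
ε*ε≡1 zero    = refl
ε*ε≡1 (suc n) = trans (neg*neg (ε n)) (ε*ε≡1 n)
  where
  neg*neg : ∀ x → (- x) * (- x) ≡ x * x
  neg*neg = solve-∀

ε-even : ∀ n → ε (2 ℕ.* n) ≡ + 1
ε-even n = begin
  ε (n ℕ.+ (n ℕ.+ 0))  ≡⟨ cong (λ k → ε (n ℕ.+ k)) (ℕ.+-identityʳ n) ⟩
  ε (n ℕ.+ n)          ≡⟨ ε-+ n n ⟩
  ε n * ε n            ≡⟨ ε*ε≡1 n ⟩
  + 1                  ∎

ε-∸ : ∀ m n → n ≤ m → ε (m ∸ n) ≡ ε m * ε n
ε-∸ m n n≤m = begin
  ε (m ∸ n)                   ≡⟨ sym (ℤ.*-identityʳ _) ⟩
  ε (m ∸ n) * + 1             ≡⟨ cong (ε (m ∸ n) *_) (sym (ε*ε≡1 n)) ⟩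
  ε (m ∸ n) * (ε n * ε n)     ≡⟨ sym (ℤ.*-assoc (ε (m ∸ n)) (ε n) (ε n)) ⟩
  (ε (m ∸ n) * ε n) * ε n     ≡⟨ cong (_* ε n) (sym (ε-+ (m ∸ n) n)) ⟩
  ε (m ∸ n ℕ.+ n) * ε n       ≡⟨ cong (λ k → ε k * ε n) (ℕ.m∸n+n≡m n≤m) ⟩
  ε m * ε n                   ∎

sgn[A+C-I-J+1] : ∀ A C I J → sgn (+ A + + C - + I - + J + + 1) ≡ - ((ε A * ε I) * (ε C * ε J))
sgn[A+C-I-J+1] A C I J = begin
  sgn (+ A + + C - + I - + J + + 1)   ≡⟨ sgn≡εℤ (+ A + + C - + I - + J + + 1) ⟩
  εℤ (+ A + + C - + I - + J + + 1)    ≡⟨ εℤ-+ (+ A + + C - + I - + J) (+ 1) ⟩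
  εℤ (+ A + + C - + I - + J) * - + 1  ≡⟨ cong (_* - + 1) (εℤ-- (+ A + + C - + I) (+ J)) ⟩
  εℤ (+ A + + C - + I) * ε J * - + 1  ≡⟨ cong (λ z → z * ε J * - + 1) (εℤ-- (+ A + + C) (+ I)) ⟩
  ε (A ℕ.+ C) * ε I * ε J * - + 1     ≡⟨ cong (λ z → z * ε I * ε J * - + 1) (ε-+ A C) ⟩
  ε A * ε C * ε I * ε J * - + 1       ≡⟨ regroup (ε A) (ε C) (ε I) (ε J) ⟩
  - ((ε A * ε I) * (ε C * ε J))       ∎
  where
  regroup : ∀ a c i j → a * c * i * j * - + 1 ≡ - ((a * i) * (c * j))
  regroup = solve-∀

sgn[A-I-J+1] : ∀ A I J → sgn (+ A - + I - + J + + 1) ≡ - ((ε A * ε I) * ε J)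
sgn[A-I-J+1] A I J = begin
  sgn (+ A - + I - + J + + 1)   ≡⟨ sgn≡εℤ (+ A - + I - + J + + 1) ⟩
  εℤ (+ A - + I - + J + + 1)    ≡⟨ εℤ-+ (+ A - + I - + J) (+ 1) ⟩
  εℤ (+ A - + I - + J) * - + 1  ≡⟨ cong (_* - + 1) (εℤ-- (+ A - + I) (+ J)) ⟩
  εℤ (+ A - + I) * ε J * - + 1  ≡⟨ cong (λ z → z * ε J * - + 1) (εℤ-- (+ A) (+ I)) ⟩
  ε A * ε I * ε J * - + 1       ≡⟨ regroup (ε A) (ε I) (ε J) ⟩
  - ((ε A * ε I) * ε J)         ∎
  where
  regroup : ∀ a i j → a * i * j * - + 1 ≡ - ((a * i) * j)
  regroup = solve-∀

sgn[A-B+K-I] : ∀ A B K I → sgn (+ A - + B + + K - + I) ≡ (ε A * ε I) * (ε K * ε B)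
sgn[A-B+K-I] A B K I = begin
  sgn (+ A - + B + + K - + I)   ≡⟨ sgn≡εℤ (+ A - + B + + K - + I) ⟩
  εℤ (+ A - + B + + K - + I)    ≡⟨ εℤ-- (+ A - + B + + K) (+ I) ⟩
  εℤ (+ A - + B + + K) * ε I    ≡⟨ cong (_* ε I) (εℤ-+ (+ A - + B) (+ K)) ⟩
  εℤ (+ A - + B) * ε K * ε I    ≡⟨ cong (λ z → z * ε K * ε I) (εℤ-- (+ A) (+ B)) ⟩
  ε A * ε B * ε K * ε I         ≡⟨ regroup (ε A) (ε B) (ε K) (ε I) ⟩
  (ε A * ε I) * (ε K * ε B)     ∎
  where
  regroup : ∀ a b k i → a * b * k * i ≡ (a * i) * (k * b)
  regroup = solve-∀

∑-ε : ∀ a d → + 2 * ∑ (suc a) d ε ≡ ε (a ℕ.+ d) - ε a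
∑-ε a d = begin
  + 2 * ∑ (suc a) d ε                    ≡⟨ sym (∑-*ˡ (suc a) d (+ 2) ε) ⟩
  ∑ (suc a) d (λ j → + 2 * ε j)          ≡⟨ ∑-cong′ (suc a) d (λ j → step (ε j)) ⟩
  ∑ (suc a) d (λ j → G (suc j) - G j)    ≡⟨ ∑-telescope (suc a) d G ⟩
  G (suc a ℕ.+ d) - G (suc a)            ≡⟨ simplify (ε (a ℕ.+ d)) (ε a) ⟩
  ε (a ℕ.+ d) - ε a                      ∎
  where
  G : ℕ → ℤ
  G j = - ε j
  step : ∀ e → + 2 * e ≡ - (- e) - (- e)
  step = solve-∀
  simplify : ∀ x y → - (- x) - (- (- y)) ≡ x - y
  simplify = solve-∀

∑-ε-linear : ∀ a d k → + 4 * ∑ (suc a) d (λ j → ε j * (+ k - + j))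
  ≡ ε a * (+ 2 * + a - + 2 * + k + + 1) - ε (a ℕ.+ d) * (+ 2 * + (a ℕ.+ d) - + 2 * + k + + 1)
∑-ε-linear a d k = begin
  + 4 * ∑ (suc a) d (λ j → ε j * (+ k - + j))          ≡⟨ sym (∑-*ˡ (suc a) d (+ 4) _) ⟩
  ∑ (suc a) d (λ j → + 4 * (ε j * (+ k - + j)))        ≡⟨ ∑-cong′ (suc a) d (λ j → step (ε j) (+ j) (+ k)) ⟩
  ∑ (suc a) d (λ j → G (suc j) - G j)                  ≡⟨ ∑-telescope (suc a) d G ⟩
  G (suc a ℕ.+ d) - G (suc a)                          ≡⟨ simplify (ε (a ℕ.+ d)) (ε a) (+ (a ℕ.+ d)) (+ a) (+ k) ⟩
  ε a * (+ 2 * + a - + 2 * + k + + 1) - ε (a ℕ.+ d) * (+ 2 * + (a ℕ.+ d) - + 2 * + k + + 1) ∎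
  where
  G : ℕ → ℤ
  G j = ε j * (+ 2 * + j - + 2 * + k - + 1)
  step : ∀ e j k → + 4 * (e * (k - j)) ≡ (- e) * (+ 2 * (+ 1 + j) - + 2 * k - + 1) - e * (+ 2 * j - + 2 * k - + 1)
  step = solve-∀
  simplify : ∀ x y X Y K → (- x) * (+ 2 * (+ 1 + X) - + 2 * K - + 1) - (- y) * (+ 2 * (+ 1 + Y) - + 2 * K - + 1)
                          ≡ y * (+ 2 * Y - + 2 * K + + 1) - x * (+ 2 * X - + 2 * K + + 1)
  simplify = solve-∀

-- Partitions and their conjugates

count : ℕ → List ℕ → ℕ
count j xs = length (filter (j ≤?_) xs)

part-beyond-length : ∀ xs {i} → length xs < i → part xs i ≡ 0
part-beyond-length []           _               = refl
part-beyond-length (x ∷ xs) {suc zero}    (s≤s ())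
part-beyond-length (x ∷ xs) {suc (suc i)} (s≤s len<i) = part-beyond-length xs len<i

part-applyUpTo : ∀ (h : ℕ → ℕ) {m i} → i < m → part (applyUpTo h m) (suc i) ≡ h i
part-applyUpTo h {suc m} {zero}  _           = refl
part-applyUpTo h {suc m} {suc i} (s≤s i<m) = part-applyUpTo (h ∘ suc) i<m

part-antitone-suc : ∀ {xs} → Linked _≥_ xs → ∀ {i} → 1 ≤ i → part xs (suc i) ≤ part xs i
part-antitone-suc {[]}        _                 _             = z≤n
part-antitone-suc {_ ∷ []}    _                 {suc zero}  _ = z≤n
part-antitone-suc {_ ∷ _ ∷ _} (x≥y Linked.∷ _)  {suc zero}  _ = x≥y
part-antitone-suc {_ ∷ _}     xs↓               {suc (suc i)} _ = part-antitone-suc (Linked.tail xs↓) (s≤s z≤n)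

part-antitone : ∀ {xs} → Linked _≥_ xs → ∀ {i j} → 1 ≤ i → i ≤ j → part xs j ≤ part xs i
part-antitone xs↓ {zero}  {zero}  () _
part-antitone xs↓ {suc _} {zero}  _  ()
part-antitone xs↓ {i}     {suc j} 1≤i i≤1+j with ℕ.m≤n⇒m<n∨m≡n i≤1+j
... | inj₂ refl      = ℕ.≤-refl
... | inj₁ (s≤s i≤j) = ℕ.≤-trans (part-antitone-suc xs↓ (ℕ.≤-trans 1≤i i≤j)) (part-antitone xs↓ 1≤i i≤j)

count-threshold : ∀ xs {j} k → (∀ i → 1 ≤ i → i ≤ k → j ≤ part xs i) → (∀ i → k < i → part xs i < j) →
                  count j xs ≡ k
count-threshold []       zero    _     _     = refl
count-threshold []       (suc k) above below = contradiction (above 1 (s≤s z≤n) (s≤s z≤n)) (ℕ.<⇒≱ (below (suc (suc k)) ℕ.≤-refl))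
count-threshold (x ∷ xs) {j} zero above below = begin
  count j (x ∷ xs) ≡⟨ cong length (List.filter-reject (j ≤?_) (ℕ.<⇒≱ (below 1 (s≤s z≤n)))) ⟩
  count j xs       ≡⟨ count-threshold xs 0 (λ { zero () _ ; (suc _) _ () }) below′ ⟩
  0                ∎
  where
  below′ : ∀ i → 0 < i → part xs i < j
  below′ (suc i) _ = below (suc (suc i)) (s≤s z≤n)
count-threshold (x ∷ xs) {j} (suc k) above below = begin
  count j (x ∷ xs)   ≡⟨ cong length (List.filter-accept (j ≤?_) (above 1 (s≤s z≤n) (s≤s z≤n))) ⟩
  suc (count j xs)   ≡⟨ cong suc (count-threshold xs k above′ below′) ⟩
  suc k              ∎
  where
  above′ : ∀ i → 1 ≤ i → i ≤ k → j ≤ part xs i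
  above′ (suc i) _ i≤k = above (suc (suc i)) (s≤s z≤n) (s≤s i≤k)
  below′ : ∀ i → k < i → part xs i < j
  below′ (suc i) k<1+i = below (suc (suc i)) (s≤s k<1+i)

count-dual : ∀ {xs} → Linked _≥_ xs → ∀ {r s} → 1 ≤ r → 1 ≤ s →
             (s ≤ count r xs → r ≤ part xs s) × (r ≤ part xs s → s ≤ count r xs)
count-dual {[]}     _   (s≤s z≤n) (s≤s z≤n) = (λ ()) , (λ ())
count-dual {x ∷ xs} xs↓ {r} {s} 1≤r 1≤s with r ≤? x
... | yes r≤x = first-row s 1≤s
  where
  count≡ : count r (x ∷ xs) ≡ suc (count r xs)
  count≡ = cong length (List.filter-accept (r ≤?_) r≤x)
  first-row : ∀ s → 1 ≤ s → (s ≤ count r (x ∷ xs) → r ≤ part (x ∷ xs) s) × (r ≤ part (x ∷ xs) s → s ≤ count r (x ∷ xs))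
  first-row (suc zero)    _ = (λ _ → r≤x) , (λ _ → subst (1 ≤_) (sym count≡) (s≤s z≤n))
  first-row (suc (suc s)) _ with count-dual (Linked.tail xs↓) 1≤r (s≤s {n = s} z≤n)
  ... | to , from = to ∘ ℕ.≤-pred ∘ subst (suc (suc s) ≤_) count≡ , subst (suc (suc s) ≤_) (sym count≡) ∘ s≤s ∘ from
... | no r≰x = (λ s≤count → contradiction (r≤tail (subst (s ≤_) count≡ s≤count)) r≰x)
             , (λ r≤part → contradiction (ℕ.≤-trans r≤part (part-antitone xs↓ (s≤s z≤n) 1≤s)) r≰x)
  where
  count≡ : count r (x ∷ xs) ≡ count r xs
  count≡ = cong length (List.filter-reject (r ≤?_) r≰x)
  r≤tail : s ≤ count r xs → r ≤ x
  r≤tail s≤count = ℕ.≤-trans (proj₁ (count-dual (Linked.tail xs↓) 1≤r 1≤s) s≤count)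
    (ℕ.≤-trans (part-antitone (Linked.tail xs↓) (s≤s z≤n) 1≤s) (part-antitone-suc xs↓ (s≤s z≤n)))

conj≡applyUpTo : ∀ xs → conj xs ≡ applyUpTo (λ k → count (suc k) xs) (part xs 1)
conj≡applyUpTo xs = trans (cong (map (λ j → count j xs)) (List.map-applyUpTo (λ k → k) suc (part xs 1)))
                          (List.map-applyUpTo suc (λ j → count j xs) (part xs 1))

length-conj : ∀ xs → length (conj xs) ≡ part xs 1
length-conj xs = trans (cong length (conj≡applyUpTo xs)) (List.length-applyUpTo _ (part xs 1))

part-conj-inRange : ∀ xs {j} → 1 ≤ j → j ≤ part xs 1 → part (conj xs) j ≡ count j xs
part-conj-inRange xs {suc j} _ j<len = trans (cong (λ ys → part ys (suc j)) (conj≡applyUpTo xs)) (part-applyUpTo _ j<len)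

module Conjugate {μ : List ℕ} (μ↓ : Linked _≥_ μ) where

  part-conj : ∀ {j} → 1 ≤ j → part (conj μ) j ≡ count j μ
  part-conj {j} 1≤j with j ≤? part μ 1
  ... | yes j≤μ₁ = part-conj-inRange μ 1≤j j≤μ₁
  ... | no  j≰μ₁ = begin
    part (conj μ) j ≡⟨ part-beyond-length (conj μ) (subst (_< j) (sym (length-conj μ)) (ℕ.≰⇒> j≰μ₁)) ⟩
    0               ≡⟨ sym (count-threshold μ 0 (λ { zero () _ ; (suc _) _ () }) below) ⟩
    count j μ       ∎
    where
    below : ∀ i → 0 < i → part μ i < j
    below i 1≤i = ℕ.≤-<-trans (part-antitone μ↓ (s≤s z≤n) 1≤i) (ℕ.≰⇒> j≰μ₁)

  conj-dual : ∀ {r s} → 1 ≤ r → 1 ≤ s → (s ≤ part (conj μ) r → r ≤ part μ s) × (r ≤ part μ s → s ≤ part (conj μ) r)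
  conj-dual 1≤r 1≤s with count-dual μ↓ 1≤r 1≤s
  ... | to , from = to ∘ subst (_ ≤_) (part-conj 1≤r) , subst (_ ≤_) (sym (part-conj 1≤r)) ∘ from

  part-conj-block : ∀ {k j} → 1 ≤ k → part μ (suc k) < j → j ≤ part μ k → part (conj μ) j ≡ k
  part-conj-block {k} {j} 1≤k below above = ℕ.≤-antisym conj≤k k≤conj
    where
    1≤j : 1 ≤ j
    1≤j = ℕ.≤-trans (s≤s z≤n) below
    k≤conj : k ≤ part (conj μ) j
    k≤conj = proj₂ (conj-dual 1≤j 1≤k) above
    conj≤k : part (conj μ) j ≤ k
    conj≤k = ℕ.≮⇒≥ λ k<conj → ℕ.<⇒≱ below (proj₁ (conj-dual 1≤j (s≤s z≤n)) k<conj)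

  part-conj≤length : ∀ {r} → 1 ≤ r → part (conj μ) r ≤ length μ
  part-conj≤length {r} 1≤r = subst (_≤ length μ) (sym (part-conj 1≤r)) (List.length-filter (r ≤?_) μ)

  part-conj-conj : ∀ {s} → 1 ≤ s → s ≤ part (conj μ) 1 → part (conj (conj μ)) s ≡ part μ s
  part-conj-conj {s} 1≤s s≤μ′₁ = begin
    part (conj (conj μ)) s ≡⟨ part-conj-inRange (conj μ) 1≤s s≤μ′₁ ⟩
    count s (conj μ)       ≡⟨ count-threshold (conj μ) (part μ s) above below ⟩
    part μ s               ∎
    where
    above : ∀ r → 1 ≤ r → r ≤ part μ s → s ≤ part (conj μ) r
    above r 1≤r = proj₂ (conj-dual 1≤r 1≤s)
    below : ∀ r → part μ s < r → part (conj μ) r < s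
    below r μₛ<r = ℕ.≰⇒> λ s≤μ′ᵣ → ℕ.<⇒≱ μₛ<r (proj₁ (conj-dual (ℕ.≤-trans (s≤s z≤n) μₛ<r) 1≤s) s≤μ′ᵣ)

-- Row sums over a Young diagram

-- l and c stand for λ and λ′ padded with zeros; c-block is all that is used about λ′.
module Diagram (N : ℕ) (εN≡1 : ε N ≡ + 1) (l c : ℕ → ℕ)
  (l-antitone : ∀ {k} → 1 ≤ k → l (suc k) ≤ l k)
  (l-vanishes : l (suc N) ≡ 0)
  (c-block : ∀ {k j} → 1 ≤ k → l (suc k) < j → j ≤ l k → c j ≡ k) where

  tail : ℕ → (ℕ → ℤ) → ℤ
  tail i f = ∑ (suc i) (N ∸ i) f

  block : (ℕ → ℤ) → ℕ → ℤ
  block ψ k = ∑ (suc (l (suc k))) (l k ∸ l (suc k)) ψ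

  ∑-blocks-from : ∀ (ψ : ℕ → ℤ) i m → 1 ≤ i → ∑ 1 (l i) ψ ≡ ∑ i m (block ψ) + ∑ 1 (l (i ℕ.+ m)) ψ
  ∑-blocks-from ψ i zero    _   = begin
    ∑ 1 (l i) ψ                      ≡⟨ sym (ℤ.+-identityˡ _) ⟩
    + 0 + ∑ 1 (l i) ψ                ≡⟨ cong (λ k → + 0 + ∑ 1 (l k) ψ) (sym (ℕ.+-identityʳ i)) ⟩
    + 0 + ∑ 1 (l (i ℕ.+ 0)) ψ        ∎
  ∑-blocks-from ψ i (suc m) 1≤i = begin
    ∑ 1 (l i) ψ                                              ≡⟨ ∑-blocks-from ψ i m 1≤i ⟩
    B + ∑ 1 (l k) ψ                                          ≡⟨ cong (λ n → B + ∑ 1 n ψ) (sym (ℕ.m+[n∸m]≡n (l-antitone 1≤k))) ⟩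
    B + ∑ 1 (l (suc k) ℕ.+ (l k ∸ l (suc k))) ψ              ≡⟨ cong (_+_ B) (∑-++ 1 (l (suc k)) _ ψ) ⟩
    B + (∑ 1 (l (suc k)) ψ + block ψ k)                      ≡⟨ regroup B _ _ ⟩
    (B + block ψ k) + ∑ 1 (l (suc k)) ψ
      ≡⟨ cong₂ _+_ (sym (∑-snoc i m (block ψ))) (cong (λ n → ∑ 1 (l n) ψ) (sym (ℕ.+-suc i m))) ⟩
    ∑ i (suc m) (block ψ) + ∑ 1 (l (i ℕ.+ suc m)) ψ          ∎
    where
    k = i ℕ.+ m
    B = ∑ i m (block ψ)
    1≤k : 1 ≤ k
    1≤k = ℕ.≤-trans 1≤i (ℕ.m≤m+n i m)
    regroup : ∀ x y z → x + (y + z) ≡ (x + z) + y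
    regroup = solve-∀

  ∑-blocks : ∀ (ψ : ℕ → ℤ) {i} → 1 ≤ i → i ≤ N → ∑ 1 (l i) ψ ≡ ∑ i (suc (N ∸ i)) (block ψ)
  ∑-blocks ψ {i} 1≤i i≤N = begin
    ∑ 1 (l i) ψ                                   ≡⟨ ∑-blocks-from ψ i (suc (N ∸ i)) 1≤i ⟩
    B + ∑ 1 (l (i ℕ.+ suc (N ∸ i))) ψ             ≡⟨ cong (λ k → B + ∑ 1 (l k) ψ) i+[1+N-i]≡1+N ⟩
    B + ∑ 1 (l (suc N)) ψ                         ≡⟨ cong (λ n → B + ∑ 1 n ψ) l-vanishes ⟩
    B + + 0                                       ≡⟨ ℤ.+-identityʳ B ⟩
    B                                             ∎
    where
    B = ∑ i (suc (N ∸ i)) (block ψ)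
    i+[1+N-i]≡1+N : i ℕ.+ suc (N ∸ i) ≡ suc N
    i+[1+N-i]≡1+N = trans (ℕ.+-suc i (N ∸ i)) (cong suc (ℕ.m+[n∸m]≡n i≤N))

  ∑-columns : ∀ (φ : ℕ → ℕ → ℤ) {i} → 1 ≤ i → i ≤ N →
    ∑ 1 (l i) (λ j → φ (c j) j) ≡ ∑ i (suc (N ∸ i)) (λ k → block (φ k) k)
  ∑-columns φ {i} 1≤i i≤N = trans (∑-blocks (λ j → φ (c j) j) 1≤i i≤N)
    (∑-cong i (suc (N ∸ i)) λ k i≤k _ → ∑-cong _ _ λ j below above →
      cong (λ k′ → φ k′ j) (c-block (ℕ.≤-trans 1≤i i≤k) below (≤l k i≤k above)))
    where
    ≤l : ∀ k {j} → i ≤ k → j < suc (l (suc k)) ℕ.+ (l k ∸ l (suc k)) → j ≤ l k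
    ≤l k {j} i≤k j< = ℕ.≤-pred (subst (j <_) (cong suc (ℕ.m+[n∸m]≡n (l-antitone (ℕ.≤-trans 1≤i i≤k)))) j<)

  g : ℕ → ℤ
  g k = ε k * ε (l k)

  g[1+N]≡-1 : g (suc N) ≡ - + 1
  g[1+N]≡-1 = begin
    - ε N * ε (l (suc N)) ≡⟨ cong₂ (λ x y → - x * ε y) εN≡1 l-vanishes ⟩
    - + 1 * + 1           ≡⟨⟩
    - + 1                 ∎

  alternating-columns : ∀ {i} → 1 ≤ i → i ≤ N →
    + 2 * ∑ 1 (l i) (λ j → ε (c j) * ε j) ≡ g i + + 2 * tail i g - + 1
  alternating-columns {i} 1≤i i≤N = begin
    + 2 * ∑ 1 (l i) (λ j → ε (c j) * ε j)                    ≡⟨ cong (_*_ (+ 2)) (∑-columns (λ k j → ε k * ε j) 1≤i i≤N) ⟩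
    + 2 * ∑ i (suc (N ∸ i)) (λ k → block (λ j → ε k * ε j) k)
      ≡⟨ sym (∑-*ˡ i (suc (N ∸ i)) (+ 2) (λ k → block (λ j → ε k * ε j) k)) ⟩
    ∑ i (suc (N ∸ i)) (λ k → + 2 * block (λ j → ε k * ε j) k)
      ≡⟨ ∑-cong i (suc (N ∸ i)) (λ k i≤k _ → twice-block (ℕ.≤-trans 1≤i i≤k)) ⟩
    ∑ i (suc (N ∸ i)) (λ k → g k + g (suc k))                 ≡⟨ ∑-stagger i (N ∸ i) g g ⟩
    g i + ∑ (suc i) (N ∸ i) (λ k → g k + g k) + g (suc (i ℕ.+ (N ∸ i)))
      ≡⟨ cong₂ (λ x y → g i + x + y) (trans (∑-cong′ (suc i) (N ∸ i) (λ k → sym (double (g k)))) (∑-*ˡ (suc i) (N ∸ i) (+ 2) g))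
                                      (trans (cong (λ n → g (suc n)) (ℕ.m+[n∸m]≡n i≤N)) g[1+N]≡-1) ⟩
    g i + + 2 * tail i g - + 1                                ∎
    where
    double : ∀ x → + 2 * x ≡ x + x
    double = solve-∀
    twice-block : ∀ {k} → 1 ≤ k → + 2 * block (λ j → ε k * ε j) k ≡ g k + g (suc k)
    twice-block {k} 1≤k = begin
      + 2 * block (λ j → ε k * ε j) k
        ≡⟨ cong (_*_ (+ 2)) (∑-*ˡ (suc (l (suc k))) (l k ∸ l (suc k)) (ε k) ε) ⟩
      + 2 * (ε k * block ε k)                               ≡⟨ reassoc (ε k) (block ε k) ⟩
      ε k * (+ 2 * block ε k)                               ≡⟨ cong (_*_ (ε k)) (∑-ε (l (suc k)) (l k ∸ l (suc k))) ⟩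
      ε k * (ε (l (suc k) ℕ.+ (l k ∸ l (suc k))) - ε (l (suc k)))
        ≡⟨ cong (λ n → ε k * (ε n - ε (l (suc k)))) (ℕ.m+[n∸m]≡n (l-antitone 1≤k)) ⟩
      ε k * (ε (l k) - ε (l (suc k)))                       ≡⟨ distrib (ε k) (ε (l k)) (ε (l (suc k))) ⟩
      g k + g (suc k)                                       ∎
      where
      reassoc : ∀ x y → + 2 * (x * y) ≡ x * (+ 2 * y)
      reassoc = solve-∀
      distrib : ∀ x y z → x * (y - z) ≡ x * y + (- x) * z
      distrib = solve-∀

  row-sign-identity : ∀ {i} → 1 ≤ i → i ≤ N →
    ∑ 1 (l i) (λ j → sgn (+ l i + + c j - + i - + j + + 1))
    ≡ ∑ 1 (l i ℕ.+ (N ∸ i)) (λ j → sgn (+ l i - + i - + j + + 1)) - tail i (λ j → sgn (+ l i - + l j + + j - + i))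
  row-sign-identity {i} 1≤i i≤N = ℤ.*-cancelˡ-≡ (+ 2) _ _ (begin
    + 2 * ∑ 1 (l i) (λ j → sgn (+ l i + + c j - + i - + j + + 1))   ≡⟨ cong (_*_ (+ 2)) hooks ⟩
    + 2 * - (a * W)                   ≡⟨ step₁ a W ⟩
    - a * (+ 2 * W)                   ≡⟨ cong (λ x → - a * x) 2W≡a+2T-1 ⟩
    - a * (a + + 2 * T - + 1)         ≡⟨ step₂ a T ⟩
    - a * (a - + 1) - + 2 * (a * T)   ≡⟨ cong (λ x → - a * x - + 2 * (a * T)) (sym 2P≡a-1) ⟩
    - a * (+ 2 * P) - + 2 * (a * T)   ≡⟨ step₃ a P T ⟩
    + 2 * (- (a * P) - a * T)         ≡⟨ cong (_*_ (+ 2)) (sym (cong₂ _-_ δ-cells pairs)) ⟩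
    + 2 * (∑ 1 β (λ j → sgn (+ l i - + i - + j + + 1)) - tail i (λ j → sgn (+ l i - + l j + + j - + i))) ∎)
    where
    a = ε (l i) * ε i
    β = l i ℕ.+ (N ∸ i)
    W = ∑ 1 (l i) (λ j → ε (c j) * ε j)
    P = ∑ 1 β ε
    T = tail i g
    hooks : ∑ 1 (l i) (λ j → sgn (+ l i + + c j - + i - + j + + 1)) ≡ - (a * W)
    hooks = begin
      _                                      ≡⟨ ∑-cong′ 1 (l i) (λ j → sgn[A+C-I-J+1] (l i) (c j) i j) ⟩
      ∑ 1 (l i) (λ j → - (a * (ε (c j) * ε j))) ≡⟨ ∑-neg 1 (l i) _ ⟩
      - ∑ 1 (l i) (λ j → a * (ε (c j) * ε j))   ≡⟨ cong -_ (∑-*ˡ 1 (l i) a _) ⟩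
      - (a * W)                              ∎
    δ-cells : ∑ 1 β (λ j → sgn (+ l i - + i - + j + + 1)) ≡ - (a * P)
    δ-cells = trans (∑-cong′ 1 β (λ j → sgn[A-I-J+1] (l i) i j)) (trans (∑-neg 1 β _) (cong -_ (∑-*ˡ 1 β a ε)))
    pairs : tail i (λ j → sgn (+ l i - + l j + + j - + i)) ≡ a * T
    pairs = trans (∑-cong′ (suc i) (N ∸ i) (λ j → sgn[A-B+K-I] (l i) (l j) j i)) (∑-*ˡ (suc i) (N ∸ i) a g)
    2W≡a+2T-1 : + 2 * W ≡ a + + 2 * T - + 1
    2W≡a+2T-1 = trans (alternating-columns 1≤i i≤N) (cong (λ x → x + + 2 * T - + 1) (ℤ.*-comm (ε i) (ε (l i))))
    εβ≡a : ε β ≡ a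
    εβ≡a = begin
      ε β                      ≡⟨ ε-+ (l i) (N ∸ i) ⟩
      ε (l i) * ε (N ∸ i)      ≡⟨ cong (_*_ (ε (l i))) (ε-∸ N i i≤N) ⟩
      ε (l i) * (ε N * ε i)    ≡⟨ cong (λ x → ε (l i) * (x * ε i)) εN≡1 ⟩
      ε (l i) * (+ 1 * ε i)    ≡⟨ cong (_*_ (ε (l i))) (ℤ.*-identityˡ (ε i)) ⟩
      a                        ∎
    2P≡a-1 : + 2 * P ≡ a - + 1
    2P≡a-1 = trans (∑-ε 0 β) (cong (_- + 1) εβ≡a)
    step₁ : ∀ a W → + 2 * - (a * W) ≡ - a * (+ 2 * W)
    step₁ = solve-∀
    step₂ : ∀ a T → - a * (a + + 2 * T - + 1) ≡ - a * (a - + 1) - + 2 * (a * T)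
    step₂ = solve-∀
    step₃ : ∀ a P T → - a * (+ 2 * P) - + 2 * (a * T) ≡ + 2 * (- (a * P) - a * T)
    step₃ = solve-∀

  row-identity : ∀ {i} → 1 ≤ i → i ≤ N →
    ∑ 1 (l i) (λ j → sgn (+ l i + + c j - + i - + j + + 1) * (+ l i - + i))
    ≡ ∑ 1 (l i ℕ.+ (N ∸ i)) (λ j → sgn (+ l i - + i - + j + + 1) * (+ l i - + i))
      - tail i (λ j → sgn (+ l i - + l j + + j - + i) * (+ l i - + i))
  row-identity {i} 1≤i i≤N = begin
    ∑ 1 (l i) (λ j → sgn (+ l i + + c j - + i - + j + + 1) * w) ≡⟨ ∑-*ʳ 1 (l i) w _ ⟩
    ∑ 1 (l i) (λ j → sgn (+ l i + + c j - + i - + j + + 1)) * w ≡⟨ cong (_* w) (row-sign-identity 1≤i i≤N) ⟩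
    (Δ - P) * w                                                  ≡⟨ distrib Δ P w ⟩
    Δ * w - P * w
      ≡⟨ sym (cong₂ _-_ (∑-*ʳ 1 (l i ℕ.+ (N ∸ i)) w _) (∑-*ʳ (suc i) (N ∸ i) w _)) ⟩
    ∑ 1 (l i ℕ.+ (N ∸ i)) (λ j → sgn (+ l i - + i - + j + + 1) * w) - tail i (λ j → sgn (+ l i - + l j + + j - + i) * w) ∎
    where
    w = + l i - + i
    Δ = ∑ 1 (l i ℕ.+ (N ∸ i)) (λ j → sgn (+ l i - + i - + j + + 1))
    P = tail i (λ j → sgn (+ l i - + l j + + j - + i))
    distrib : ∀ x y z → (x - y) * z ≡ x * z - y * z
    distrib = solve-∀

  h : ℕ → ℤ
  h k = g k * (+ l k - + k)

  rowWeight : ℕ → ℤ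
  rowWeight i = + 2 * + l i - + 2 * + i + + 1

  weighted-alternating-columns : ∀ {i} → 1 ≤ i → i ≤ N →
    + 4 * ∑ 1 (l i) (λ j → ε (c j) * ε j * (+ c j - + j))
    ≡ - (g i * rowWeight i) - (+ 4 * tail i h + + 4 * tail i g) + (+ 1 - + 2 * + N)
  weighted-alternating-columns {i} 1≤i i≤N = begin
    + 4 * ∑ 1 (l i) (λ j → ε (c j) * ε j * (+ c j - + j))       ≡⟨ cong (_*_ (+ 4)) (∑-columns φ 1≤i i≤N) ⟩
    + 4 * ∑ i (suc (N ∸ i)) (λ k → block (φ k) k)                ≡⟨ sym (∑-*ˡ i (suc (N ∸ i)) (+ 4) (λ k → block (φ k) k)) ⟩
    ∑ i (suc (N ∸ i)) (λ k → + 4 * block (φ k) k)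
      ≡⟨ ∑-cong i (suc (N ∸ i)) (λ k i≤k _ → four-block (ℕ.≤-trans 1≤i i≤k)) ⟩
    ∑ i (suc (N ∸ i)) (λ k → u k + w (suc k))                    ≡⟨ ∑-stagger i (N ∸ i) u w ⟩
    u i + tail i (λ k → u k + w k) + w (suc (i ℕ.+ (N ∸ i)))
      ≡⟨ cong₂ (λ x y → u i + x + y) tails (cong (λ n → w (suc n)) (ℕ.m+[n∸m]≡n i≤N)) ⟩
    u i - (+ 4 * tail i h + + 4 * tail i g) + w (suc N)
      ≡⟨ cong (λ x → u i - (+ 4 * tail i h + + 4 * tail i g) + x) w[1+N] ⟩
    u i - (+ 4 * tail i h + + 4 * tail i g) + (+ 1 - + 2 * + N)  ∎
    where
    φ : ℕ → ℕ → ℤ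
    φ k j = ε k * ε j * (+ k - + j)
    u w : ℕ → ℤ
    u k = - (g k * rowWeight k)
    w k = - (g k * (+ 2 * + l k - + 2 * + k + + 3))
    four-block : ∀ {k} → 1 ≤ k → + 4 * block (φ k) k ≡ u k + w (suc k)
    four-block {k} 1≤k = begin
      + 4 * block (φ k) k
        ≡⟨ cong (_*_ (+ 4)) (∑-cong′ (suc a) (l k ∸ a) (λ j → ℤ.*-assoc (ε k) (ε j) (+ k - + j))) ⟩
      + 4 * block (λ j → ε k * (ε j * (+ k - + j))) k    ≡⟨ cong (_*_ (+ 4)) (∑-*ˡ (suc a) (l k ∸ a) (ε k) _) ⟩
      + 4 * (ε k * Q)                                    ≡⟨ reassoc (ε k) Q ⟩
      ε k * (+ 4 * Q)                                    ≡⟨ cong (_*_ (ε k)) (∑-ε-linear a (l k ∸ a) k) ⟩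
      ε k * (ε a * (+ 2 * + a - + 2 * + k + + 1) - ε (a ℕ.+ (l k ∸ a)) * (+ 2 * + (a ℕ.+ (l k ∸ a)) - + 2 * + k + + 1))
        ≡⟨ cong (λ n → ε k * (ε a * (+ 2 * + a - + 2 * + k + + 1) - ε n * (+ 2 * + n - + 2 * + k + + 1))) (ℕ.m+[n∸m]≡n (l-antitone 1≤k)) ⟩
      ε k * (ε a * (+ 2 * + a - + 2 * + k + + 1) - ε (l k) * (+ 2 * + l k - + 2 * + k + + 1))
        ≡⟨ regroup (ε k) (ε a) (ε (l k)) (+ a) (+ l k) (+ k) ⟩
      u k + w (suc k)                                    ∎
      where
      a = l (suc k)
      Q = block (λ j → ε j * (+ k - + j)) k
      reassoc : ∀ x y → + 4 * (x * y) ≡ x * (+ 4 * y)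
      reassoc = solve-∀
      regroup : ∀ e ea el A L K → e * (ea * (+ 2 * A - + 2 * K + + 1) - el * (+ 2 * L - + 2 * K + + 1))
                ≡ - ((e * el) * (+ 2 * L - + 2 * K + + 1)) + - ((- e * ea) * (+ 2 * A - + 2 * (+ 1 + K) + + 3))
      regroup = solve-∀
    tails : tail i (λ k → u k + w k) ≡ - (+ 4 * tail i h + + 4 * tail i g)
    tails = begin
      tail i (λ k → u k + w k)                    ≡⟨ ∑-cong′ (suc i) (N ∸ i) (λ k → combine (g k) (+ l k) (+ k)) ⟩
      tail i (λ k → - (+ 4 * h k + + 4 * g k))    ≡⟨ ∑-neg (suc i) (N ∸ i) _ ⟩
      - tail i (λ k → + 4 * h k + + 4 * g k)      ≡⟨ cong -_ (∑-+ (suc i) (N ∸ i) _ _) ⟩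
      - (tail i (λ k → + 4 * h k) + tail i (λ k → + 4 * g k))
        ≡⟨ cong -_ (cong₂ _+_ (∑-*ˡ (suc i) (N ∸ i) (+ 4) h) (∑-*ˡ (suc i) (N ∸ i) (+ 4) g)) ⟩
      - (+ 4 * tail i h + + 4 * tail i g)         ∎
      where
      combine : ∀ x L K → - (x * (+ 2 * L - + 2 * K + + 1)) + - (x * (+ 2 * L - + 2 * K + + 3)) ≡ - (+ 4 * (x * (L - K)) + + 4 * x)
      combine = solve-∀
    w[1+N] : w (suc N) ≡ + 1 - + 2 * + N
    w[1+N] = begin
      - (g (suc N) * (+ 2 * + l (suc N) - + 2 * + suc N + + 3))
        ≡⟨ cong₂ (λ x n → - (x * (+ 2 * + n - + 2 * + suc N + + 3))) g[1+N]≡-1 l-vanishes ⟩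
      - (- + 1 * (+ 2 * + 0 - + 2 * (+ 1 + + N) + + 3))          ≡⟨ simplify (+ N) ⟩
      + 1 - + 2 * + N                                            ∎
      where
      simplify : ∀ x → - (- + 1 * (+ 2 * + 0 - + 2 * (+ 1 + x) + + 3)) ≡ + 1 - + 2 * x
      simplify = solve-∀

  conjRow : ℕ → ℤ
  conjRow i = ∑ 1 (l i) (λ j → sgn (+ c j + + l i - + j - + i + + 1) * (+ c j - + j))

  pairRow : ℕ → ℤ
  pairRow i = tail i (λ k → sgn (+ l i - + l k + + k - + i) * (+ l k - + k))

  g*g≡1 : ∀ k → g k * g k ≡ + 1
  g*g≡1 k = begin
    (ε k * ε (l k)) * (ε k * ε (l k))   ≡⟨ regroup (ε k) (ε (l k)) ⟩
    (ε k * ε k) * (ε (l k) * ε (l k))   ≡⟨ cong₂ _*_ (ε*ε≡1 k) (ε*ε≡1 (l k)) ⟩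
    + 1                                 ∎
    where
    regroup : ∀ x y → (x * y) * (x * y) ≡ (x * x) * (y * y)
    regroup = solve-∀

  conjugate-row-identity : ∀ {i} → 1 ≤ i → i ≤ N →
    + 4 * conjRow i ≡ + 4 * pairRow i + rowWeight i + + 4 * (g i * tail i g) + (+ 2 * + N - + 1) * g i
  conjugate-row-identity {i} 1≤i i≤N = begin
    + 4 * conjRow i                         ≡⟨ cong (_*_ (+ 4)) hooks ⟩
    + 4 * - (g i * W)                       ≡⟨ step₁ (g i) W ⟩
    - (g i * (+ 4 * W))                     ≡⟨ cong (λ x → - (g i * x)) (weighted-alternating-columns 1≤i i≤N) ⟩
    - (g i * (- (g i * V) - (+ 4 * tail i h + + 4 * tail i g) + (+ 1 - + 2 * + N)))
                                            ≡⟨ step₂ (g i) V (tail i h) (tail i g) (+ N) ⟩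
    (g i * g i) * V + + 4 * (g i * tail i h) + + 4 * (g i * tail i g) + (+ 2 * + N - + 1) * g i
      ≡⟨ cong₂ (λ x y → x * V + + 4 * y + + 4 * (g i * tail i g) + (+ 2 * + N - + 1) * g i) (g*g≡1 i) (sym pairs) ⟩
    + 1 * V + + 4 * pairRow i + + 4 * (g i * tail i g) + (+ 2 * + N - + 1) * g i
                                            ≡⟨ step₃ V (pairRow i) (g i * tail i g) ((+ 2 * + N - + 1) * g i) ⟩
    + 4 * pairRow i + V + + 4 * (g i * tail i g) + (+ 2 * + N - + 1) * g i ∎
    where
    V = rowWeight i
    W = ∑ 1 (l i) (λ j → ε (c j) * ε j * (+ c j - + j))
    hooks : conjRow i ≡ - (g i * W)
    hooks = begin
      conjRow i
        ≡⟨ ∑-cong′ 1 (l i) (λ j → cong (_* (+ c j - + j)) (sgn[A+C-I-J+1] (c j) (l i) j i)) ⟩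
      ∑ 1 (l i) (λ j → - ((ε (c j) * ε j) * (ε (l i) * ε i)) * (+ c j - + j))
        ≡⟨ ∑-cong′ 1 (l i) (λ j → regroup (ε (c j)) (ε j) (ε (l i)) (ε i) (+ c j - + j)) ⟩
      ∑ 1 (l i) (λ j → - (g i * (ε (c j) * ε j * (+ c j - + j))))
                                                           ≡⟨ ∑-neg 1 (l i) _ ⟩
      - ∑ 1 (l i) (λ j → g i * (ε (c j) * ε j * (+ c j - + j)))
                                                           ≡⟨ cong -_ (∑-*ˡ 1 (l i) (g i) _) ⟩
      - (g i * W)                                          ∎
      where
      regroup : ∀ cj j li ii x → - ((cj * j) * (li * ii)) * x ≡ - ((ii * li) * (cj * j * x))
      regroup = solve-∀
    pairs : pairRow i ≡ g i * tail i h
    pairs = begin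
      pairRow i
        ≡⟨ ∑-cong′ (suc i) (N ∸ i) (λ k → cong (_* (+ l k - + k)) (sgn[A-B+K-I] (l i) (l k) k i)) ⟩
      tail i (λ k → (ε (l i) * ε i) * (ε k * ε (l k)) * (+ l k - + k))
        ≡⟨ ∑-cong′ (suc i) (N ∸ i) (λ k → regroup (ε (l i)) (ε i) (g k) (+ l k - + k)) ⟩
      tail i (λ k → g i * h k)                                    ≡⟨ ∑-*ˡ (suc i) (N ∸ i) (g i) h ⟩
      g i * tail i h                                              ∎
      where
      regroup : ∀ li ii gk x → (li * ii) * gk * x ≡ (ii * li) * (gk * x)
      regroup = solve-∀
    step₁ : ∀ x W → + 4 * - (x * W) ≡ - (x * (+ 4 * W))
    step₁ = solve-∀
    step₂ : ∀ x V H G N → - (x * (- (x * V) - (+ 4 * H + + 4 * G) + (+ 1 - + 2 * N)))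
            ≡ (x * x) * V + + 4 * (x * H) + + 4 * (x * G) + (+ 2 * N - + 1) * x
    step₂ = solve-∀
    step₃ : ∀ a b d e → + 1 * a + + 4 * b + + 4 * d + e ≡ + 4 * b + a + + 4 * d + e
    step₃ = solve-∀

  ∑-conjugate-row-identity :
    + 4 * ∑ 1 N conjRow ≡ + 4 * ∑ 1 N pairRow + ∑ 1 N rowWeight + + 4 * ∑ 1 N (λ i → g i * tail i g) + (+ 2 * + N - + 1) * ∑ 1 N g
  ∑-conjugate-row-identity = begin
    + 4 * ∑ 1 N conjRow                                 ≡⟨ sym (∑-*ˡ 1 N (+ 4) conjRow) ⟩
    ∑ 1 N (λ i → + 4 * conjRow i)
      ≡⟨ ∑-cong 1 N (λ i 1≤i i<1+N → conjugate-row-identity 1≤i (ℕ.≤-pred i<1+N)) ⟩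
    ∑ 1 N (λ i → + 4 * pairRow i + rowWeight i + + 4 * (g i * tail i g) + (+ 2 * + N - + 1) * g i)
      ≡⟨ ∑-+ 1 N _ _ ⟩
    ∑ 1 N (λ i → + 4 * pairRow i + rowWeight i + + 4 * (g i * tail i g)) + ∑ 1 N (λ i → (+ 2 * + N - + 1) * g i)
      ≡⟨ cong₂ _+_ (∑-+ 1 N _ _) (∑-*ˡ 1 N (+ 2 * + N - + 1) g) ⟩
    ∑ 1 N (λ i → + 4 * pairRow i + rowWeight i) + ∑ 1 N (λ i → + 4 * (g i * tail i g)) + (+ 2 * + N - + 1) * ∑ 1 N g
      ≡⟨ cong₂ (λ x y → x + y + (+ 2 * + N - + 1) * ∑ 1 N g) (∑-+ 1 N _ _) (∑-*ˡ 1 N (+ 4) _) ⟩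
    ∑ 1 N (λ i → + 4 * pairRow i) + ∑ 1 N rowWeight + + 4 * ∑ 1 N (λ i → g i * tail i g) + (+ 2 * + N - + 1) * ∑ 1 N g
      ≡⟨ cong (λ x → x + ∑ 1 N rowWeight + + 4 * ∑ 1 N (λ i → g i * tail i g) + (+ 2 * + N - + 1) * ∑ 1 N g) (∑-*ˡ 1 N (+ 4) pairRow) ⟩
    + 4 * ∑ 1 N pairRow + ∑ 1 N rowWeight + + 4 * ∑ 1 N (λ i → g i * tail i g) + (+ 2 * + N - + 1) * ∑ 1 N g ∎

  ∑-rowWeights : ∑ 1 N rowWeight ≡ + 2 * ∑ 1 N (λ i → + l i) - + N * + N
  ∑-rowWeights = begin
    ∑ 1 N rowWeight           ≡⟨ ∑-+ 1 N _ _ ⟩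
    ∑ 1 N (λ i → + 2 * + l i - + 2 * + i) + ∑ 1 N (λ _ → + 1)
                                                           ≡⟨ cong₂ _+_ (∑-- 1 N _ _) (∑-one 1 N) ⟩
    ∑ 1 N (λ i → + 2 * + l i) - ∑ 1 N (λ i → + 2 * + i) + + N
      ≡⟨ cong₂ (λ x y → x - y + + N) (∑-*ˡ 1 N (+ 2) (λ i → + l i)) (∑-*ˡ 1 N (+ 2) (λ i → + i)) ⟩
    + 2 * L - + 2 * ∑ 1 N (λ i → + i) + + N               ≡⟨ cong (λ x → + 2 * L - x + + N) (∑-naturals N) ⟩
    + 2 * L - + N * (+ N + + 1) + + N                     ≡⟨ simplify (+ 2 * L) (+ N) ⟩
    + 2 * L - + N * + N                                   ∎
    where
    L = ∑ 1 N (λ i → + l i)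
    simplify : ∀ x y → x - y * (y + + 1) + y ≡ x - y * y
    simplify = solve-∀

  ∑-g*tail : ∑ 1 N g ≡ + 0 → + 2 * ∑ 1 N (λ i → g i * tail i g) ≡ - + N
  ∑-g*tail ∑g≡0 = begin
    + 2 * Q                        ≡⟨ isolate (+ N) Q ⟩
    - + N + (+ N + + 2 * Q)        ≡⟨ cong (λ x → - + N + (x + + 2 * Q)) (sym (trans (∑-cong′ 1 N g*g≡1) (∑-one 1 N))) ⟩
    - + N + (∑ 1 N (λ i → g i * g i) + + 2 * Q) ≡⟨ cong (_+_ (- + N)) (sym (∑-square 1 N N g refl)) ⟩
    - + N + ∑ 1 N g * ∑ 1 N g      ≡⟨ cong (λ x → - + N + x * x) ∑g≡0 ⟩
    - + N + + 0                    ≡⟨ ℤ.+-identityʳ _ ⟩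
    - + N                          ∎
    where
    Q = ∑ 1 N (λ i → g i * tail i g)
    isolate : ∀ x y → + 2 * y ≡ - x + (x + + 2 * y)
    isolate = solve-∀

  ∑-conjRow : ∀ n D → N ≡ 2 ℕ.* n → ∑ 1 N g ≡ + 0 → ∑ 1 N (λ i → + l i) ≡ + 2 * + D →
    ∑ 1 N conjRow ≡ + D - + (n ℕ.* n) - + n + ∑ 1 N pairRow
  ∑-conjRow n D N≡2n ∑g≡0 ∑l≡2D = ℤ.*-cancelˡ-≡ (+ 4) _ _ (begin
    + 4 * ∑ 1 N conjRow                                       ≡⟨ ∑-conjugate-row-identity ⟩
    + 4 * T + ∑ 1 N rowWeight + + 4 * Q + (+ 2 * + N - + 1) * ∑ 1 N g
      ≡⟨ cong₂ (λ x y → + 4 * T + x + + 4 * Q + (+ 2 * + N - + 1) * y) ∑-rowWeights ∑g≡0 ⟩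
    + 4 * T + (+ 2 * ∑ 1 N (λ i → + l i) - + N * + N) + + 4 * Q + (+ 2 * + N - + 1) * + 0
      ≡⟨ regroup T (∑ 1 N (λ i → + l i)) Q (+ N) ⟩
    + 4 * T + (+ 2 * ∑ 1 N (λ i → + l i) - + N * + N) + + 2 * (+ 2 * Q)
      ≡⟨ cong₂ (λ x y → + 4 * T + (+ 2 * x - + N * + N) + + 2 * y) ∑l≡2D (∑-g*tail ∑g≡0) ⟩
    + 4 * T + (+ 2 * (+ 2 * + D) - + N * + N) + + 2 * (- + N)
      ≡⟨ cong (λ x → + 4 * T + (+ 2 * (+ 2 * + D) - x * x) + + 2 * (- x)) (trans (cong +_ N≡2n) (ℤ.pos-* 2 n)) ⟩
    + 4 * T + (+ 2 * (+ 2 * + D) - (+ 2 * + n) * (+ 2 * + n)) + + 2 * (- (+ 2 * + n))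
      ≡⟨ simplify T (+ D) (+ n) ⟩
    + 4 * (+ D - + n * + n - + n + T)                         ≡⟨ cong (λ x → + 4 * (+ D - x - + n + T)) (sym (ℤ.pos-* n n)) ⟩
    + 4 * (+ D - + (n ℕ.* n) - + n + T)                       ∎)
    where
    T = ∑ 1 N pairRow
    Q = ∑ 1 N (λ i → g i * tail i g)
    regroup : ∀ T L Q N → + 4 * T + (+ 2 * L - N * N) + + 4 * Q + (+ 2 * N - + 1) * + 0
                          ≡ + 4 * T + (+ 2 * L - N * N) + + 2 * (+ 2 * Q)
    regroup = solve-∀
    simplify : ∀ T D n → + 4 * T + (+ 2 * (+ 2 * D) - (+ 2 * n) * (+ 2 * n)) + + 2 * (- (+ 2 * n))
                         ≡ + 4 * (D - n * n - n + T)
    simplify = solve-∀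

-- Domino tilings

sumℤ-++ : ∀ xs ys → sumℤ (xs ++ ys) ≡ sumℤ xs + sumℤ ys
sumℤ-++ []       ys = sym (ℤ.+-identityˡ _)
sumℤ-++ (x ∷ xs) ys = trans (cong (_+_ x) (sumℤ-++ xs ys)) (sym (ℤ.+-assoc x _ _))

sumℤ-↭ : ∀ {xs ys} → xs ↭ ys → sumℤ xs ≡ sumℤ ys
sumℤ-↭ xs↭ys = PermSetoid.foldr-commMonoid (setoid ℤ) ℤ.+-0-isCommutativeMonoid (↭⇒↭ₛ xs↭ys)

sumℤ-map-concatMap : ∀ {A B : Set} (w : B → ℤ) (f : A → List B) xs →
  sumℤ (map w (concatMap f xs)) ≡ sumℤ (map (λ x → sumℤ (map w (f x))) xs)
sumℤ-map-concatMap w f []       = refl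
sumℤ-map-concatMap w f (x ∷ xs) = begin
  sumℤ (map w (f x ++ concatMap f xs))              ≡⟨ cong sumℤ (List.map-++ w (f x) (concatMap f xs)) ⟩
  sumℤ (map w (f x) ++ map w (concatMap f xs))      ≡⟨ sumℤ-++ (map w (f x)) _ ⟩
  sumℤ (map w (f x)) + sumℤ (map w (concatMap f xs)) ≡⟨ cong (_+_ (sumℤ (map w (f x)))) (sumℤ-map-concatMap w f xs) ⟩
  sumℤ (map w (f x)) + sumℤ (map (λ x → sumℤ (map w (f x))) xs) ∎

sumℤ-map-cells : ∀ (w : ℕ × ℕ → ℤ) μ →
  sumℤ (map w (cells μ)) ≡ ∑ 1 (length μ) (λ i → ∑ 1 (part μ i) (λ j → w (i , j)))
sumℤ-map-cells w μ = begin
  sumℤ (map w (cells μ))                                              ≡⟨ sumℤ-map-concatMap w row (range 1 (length μ)) ⟩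
  Σ[ 1 ⋯ length μ ] (λ i → sumℤ (map w (row i)))                      ≡⟨ Σ≡∑ 1 (length μ) _ ⟩
  ∑ 1 (length μ) (λ i → sumℤ (map w (row i)))
    ≡⟨ ∑-cong′ 1 (length μ) (λ i → cong sumℤ (sym (List.map-∘ (range 1 (part μ i))))) ⟩
  ∑ 1 (length μ) (λ i → Σ[ 1 ⋯ part μ i ] (λ j → w (i , j)))          ≡⟨ ∑-cong′ 1 (length μ) (λ i → Σ≡∑ 1 (part μ i) _) ⟩
  ∑ 1 (length μ) (λ i → ∑ 1 (part μ i) (λ j → w (i , j)))             ∎
  where
  row : ℕ → List (ℕ × ℕ)
  row i = map (λ j → (i , j)) (range 1 (part μ i))

sumℤ-map-tiling : ∀ (w : ℕ × ℕ → ℤ) μ D → concatMap dominoCells D ↭ cells μ →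
  sumℤ (map w (cells μ)) ≡ sumℤ (map (λ d → sumℤ (map w (dominoCells d))) D)
sumℤ-map-tiling w μ D tiling = trans (sym (sumℤ-↭ (Perm.map⁺ w tiling))) (sumℤ-map-concatMap w dominoCells D)

checkerboard : ℕ × ℕ → ℤ
checkerboard (i , j) = ε i * ε j

checkerboard-domino : ∀ d → sumℤ (map checkerboard (dominoCells d)) ≡ + 0
checkerboard-domino ((i , j) , true)  = cancel (ε i) (ε j)
  where
  cancel : ∀ x y → x * y + (x * - y + + 0) ≡ + 0
  cancel = solve-∀
checkerboard-domino ((i , j) , false) = cancel (ε i) (ε j)
  where
  cancel : ∀ x y → x * y + (- x * y + + 0) ≡ + 0
  cancel = solve-∀

tiled-checkerboard : ∀ μ → EmptyTwoCore μ → sumℤ (map checkerboard (cells μ)) ≡ + 0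
tiled-checkerboard μ (D , tiling) = begin
  sumℤ (map checkerboard (cells μ))                                        ≡⟨ sumℤ-map-tiling checkerboard μ D tiling ⟩
  sumℤ (map (λ d → sumℤ (map checkerboard (dominoCells d))) D)             ≡⟨ cong sumℤ (List.map-cong checkerboard-domino D) ⟩
  sumℤ (map (λ _ → + 0) D)                                                 ≡⟨ zeros D ⟩
  + 0                                                                      ∎
  where
  zeros : ∀ (xs : List _) → sumℤ (map (λ _ → + 0) xs) ≡ + 0
  zeros []       = refl
  zeros (_ ∷ xs) = trans (ℤ.+-identityˡ _) (zeros xs)

tiled-size : ∀ μ D → concatMap dominoCells D ↭ cells μ → sumℤ (map (λ _ → + 1) (cells μ)) ≡ + 2 * + length D
tiled-size μ D tiling = begin
  sumℤ (map (λ _ → + 1) (cells μ))                                         ≡⟨ sumℤ-map-tiling (λ _ → + 1) μ D tiling ⟩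
  sumℤ (map (λ d → sumℤ (map (λ _ → + 1) (dominoCells d))) D)              ≡⟨ cong sumℤ (List.map-cong two D) ⟩
  sumℤ (map (λ _ → + 2) D)                                                 ≡⟨ twos D ⟩
  + 2 * + length D                                                         ∎
  where
  two : ∀ d → sumℤ (map (λ _ → + 1) (dominoCells d)) ≡ + 2
  two (_ , true)  = refl
  two (_ , false) = refl
  twos : ∀ (xs : List _) → sumℤ (map (λ _ → + 2) xs) ≡ + 2 * + length xs
  twos []       = refl
  twos (_ ∷ xs) = trans (cong (_+_ (+ 2)) (twos xs)) (sym (ℤ.*-distribˡ-+ (+ 2) (+ 1) (+ length xs)))

∑-checkerboard-row : ∀ i m → + 2 * ∑ 1 m (λ j → checkerboard (i , j)) ≡ ε i * ε m - ε i
∑-checkerboard-row i m = begin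
  + 2 * ∑ 1 m (λ j → ε i * ε j)   ≡⟨ cong (_*_ (+ 2)) (∑-*ˡ 1 m (ε i) ε) ⟩
  + 2 * (ε i * ∑ 1 m ε)           ≡⟨ reassoc (ε i) (∑ 1 m ε) ⟩
  ε i * (+ 2 * ∑ 1 m ε)           ≡⟨ cong (_*_ (ε i)) (∑-ε 0 m) ⟩
  ε i * (ε m - + 1)               ≡⟨ distrib (ε i) (ε m) ⟩
  ε i * ε m - ε i                 ∎
  where
  reassoc : ∀ x y → + 2 * (x * y) ≡ x * (+ 2 * y)
  reassoc = solve-∀
  distrib : ∀ x y → x * (y - + 1) ≡ x * y - x
  distrib = solve-∀

-- The statistic b

ΣΣ≡∑∑ : ∀ a b (p q : ℕ → ℕ) (f : ℕ → ℕ → ℤ) →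
  Σ[ a ⋯ b ] (λ i → Σ[ p i ⋯ q i ] (f i)) ≡ ∑ a (suc b ∸ a) (λ i → ∑ (p i) (suc (q i) ∸ p i) (f i))
ΣΣ≡∑∑ a b p q f = trans (Σ≡∑ a b _) (∑-cong′ a (suc b ∸ a) (λ i → Σ≡∑ (p i) (q i) (f i)))

size≡∑part : ∀ μ → + size μ ≡ ∑ 1 (length μ) (λ i → + part μ i)
size≡∑part []       = refl
size≡∑part (x ∷ xs) = cong (_+_ (+ x)) (begin
  + size xs                                  ≡⟨ size≡∑part xs ⟩
  ∑ 1 (length xs) (λ i → + part xs i)        ≡⟨ ∑-cong 1 (length xs) (λ { (suc i) _ _ → refl }) ⟩
  ∑ 1 (length xs) (λ i → + part (x ∷ xs) (suc i)) ≡⟨ ∑-shift 1 (length xs) (λ i → + part (x ∷ xs) i) ⟩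
  ∑ 2 (length xs) (λ i → + part (x ∷ xs) i)  ∎)

half-double : ∀ m D → m ≡ 2 ℕ.* D → ⌊ m /2⌋ ≡ D
half-double m D refl = trans (cong ⌊_/2⌋ (cong (D ℕ.+_) (ℕ.+-identityʳ D))) (sym (ℕ.n≡⌊n+n/2⌋ D))

module Statistic (n : ℕ) {μ : List ℕ} (μ↓ : Linked _≥_ μ) (len≤2n : length μ ≤ 2 ℕ.* n) where

  N : ℕ
  N = 2 ℕ.* n

  l c : ℕ → ℕ
  l = part μ
  c = part (conj μ)

  open Conjugate μ↓
  open Diagram N (ε-even n) l c (part-antitone-suc μ↓) (part-beyond-length μ (s≤s len≤2n)) part-conj-block

  ∑-rows-extend : ∀ (φ : ℕ → ℕ → ℤ) → ∑ 1 (length μ) (λ i → ∑ 1 (l i) (φ i)) ≡ ∑ 1 N (λ i → ∑ 1 (l i) (φ i))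
  ∑-rows-extend φ = ∑-extend 1 (length μ) N _ len≤2n λ i len<i → cong (λ m → ∑ 1 m (φ i)) (part-beyond-length μ len<i)

  b≡∑δ-cells-∑pairs : b μ ≡ ∑ 1 N (λ i → ∑ 1 (l i ℕ.+ (N ∸ i)) (λ j → sgn (+ l i - + i - + j + + 1) * (+ l i - + i)))
                    - ∑ 1 N (λ i → tail i (λ j → sgn (+ l i - + l j + + j - + i) * (+ l i - + i)))
  b≡∑δ-cells-∑pairs = begin
    b μ                                    ≡⟨ ΣΣ≡∑∑ 1 (length μ) (λ _ → 1) l hook ⟩
    ∑ 1 (length μ) (λ i → ∑ 1 (l i) (hook i)) ≡⟨ ∑-rows-extend hook ⟩
    ∑ 1 N (λ i → ∑ 1 (l i) (hook i))       ≡⟨ ∑-cong 1 N (λ i 1≤i i<1+N → row-identity 1≤i (ℕ.≤-pred i<1+N)) ⟩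
    ∑ 1 N (λ i → δ-cells i - pairs i)      ≡⟨ ∑-- 1 N δ-cells pairs ⟩
    ∑ 1 N δ-cells - ∑ 1 N pairs            ∎
    where
    hook : ℕ → ℕ → ℤ
    hook i j = sgn (+ l i + + c j - + i - + j + + 1) * (+ l i - + i)
    δ-cells pairs : ℕ → ℤ
    δ-cells i = ∑ 1 (l i ℕ.+ (N ∸ i)) (λ j → sgn (+ l i - + i - + j + + 1) * (+ l i - + i))
    pairs i = tail i (λ j → sgn (+ l i - + l j + + j - + i) * (+ l i - + i))

  b-conj≡∑conjRow : b (conj μ) ≡ ∑ 1 N conjRow
  b-conj≡∑conjRow = begin
    b (conj μ)
      ≡⟨ ΣΣ≡∑∑ 1 (length (conj μ)) (λ _ → 1) c (λ r s → hook′ r (part (conj (conj μ)) s) s) ⟩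
    ∑ 1 (length (conj μ)) (λ r → ∑ 1 (c r) (λ s → hook′ r (part (conj (conj μ)) s) s))
      ≡⟨ cong (λ L → ∑ 1 L (λ r → ∑ 1 (c r) (λ s → hook′ r (part (conj (conj μ)) s) s))) (length-conj μ) ⟩
    ∑ 1 (l 1) (λ r → ∑ 1 (c r) (λ s → hook′ r (part (conj (conj μ)) s) s))
      ≡⟨ ∑-cong 1 (l 1) (λ r 1≤r _ → ∑-cong 1 (c r) λ s 1≤s s<1+cᵣ →
           cong (λ x → hook′ r x s) (part-conj-conj 1≤s (≤c₁ 1≤r 1≤s (ℕ.≤-pred s<1+cᵣ)))) ⟩
    ∑ 1 (l 1) (λ r → ∑ 1 (c r) (λ s → hook′ r (l s) s))
      ≡⟨ ∑-triangle-swap (l 1) N c l (λ r s → hook′ r (l s) s) c≤N l≤l₁ conj-dual ⟩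
    ∑ 1 N conjRow ∎
    where
    hook′ : ℕ → ℕ → ℕ → ℤ
    hook′ r λₛ s = sgn (+ c r + + λₛ - + r - + s + + 1) * (+ c r - + r)
    ≤c₁ : ∀ {r s} → 1 ≤ r → 1 ≤ s → s ≤ c r → s ≤ c 1
    ≤c₁ 1≤r 1≤s s≤cᵣ = proj₂ (conj-dual (s≤s z≤n) 1≤s) (ℕ.≤-trans 1≤r (proj₁ (conj-dual 1≤r 1≤s) s≤cᵣ))
    c≤N : ∀ r → 1 ≤ r → r ≤ l 1 → c r ≤ N
    c≤N r 1≤r _ = ℕ.≤-trans (part-conj≤length 1≤r) len≤2n
    l≤l₁ : ∀ s → 1 ≤ s → s ≤ N → l s ≤ l 1
    l≤l₁ s 1≤s _ = part-antitone μ↓ (s≤s z≤n) 1≤s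

  ∑ε≡0 : ∑ 1 N ε ≡ + 0
  ∑ε≡0 = ℤ.*-cancelˡ-≡ (+ 2) _ _ (trans (∑-ε 0 N) (cong (_- + 1) (ε-even n)))

  ∑g≡0 : EmptyTwoCore μ → ∑ 1 N g ≡ + 0
  ∑g≡0 tiled = begin
    ∑ 1 N g                                                  ≡⟨ sym (ℤ.+-identityʳ _) ⟩
    ∑ 1 N g + + 0                                            ≡⟨ cong (λ x → ∑ 1 N g - x) (sym ∑ε≡0) ⟩
    ∑ 1 N g - ∑ 1 N ε                                        ≡⟨ sym (∑-- 1 N g ε) ⟩
    ∑ 1 N (λ i → g i - ε i)                                  ≡⟨ sym (∑-cong′ 1 N (λ i → ∑-checkerboard-row i (l i))) ⟩
    ∑ 1 N (λ i → + 2 * ∑ 1 (l i) (λ j → checkerboard (i , j))) ≡⟨ ∑-*ˡ 1 N (+ 2) _ ⟩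
    + 2 * ∑ 1 N (λ i → ∑ 1 (l i) (λ j → checkerboard (i , j)))
      ≡⟨ cong (_*_ (+ 2)) (sym (∑-rows-extend (λ i j → checkerboard (i , j)))) ⟩
    + 2 * ∑ 1 (length μ) (λ i → ∑ 1 (l i) (λ j → checkerboard (i , j)))
      ≡⟨ cong (_*_ (+ 2)) (sym (sumℤ-map-cells checkerboard μ)) ⟩
    + 2 * sumℤ (map checkerboard (cells μ))         ≡⟨ cong (_*_ (+ 2)) (tiled-checkerboard μ tiled) ⟩
    + 0                                                      ∎

  ∑l≡cells : ∑ 1 N (λ i → + l i) ≡ sumℤ (map (λ _ → + 1) (cells μ))
  ∑l≡cells = begin
    ∑ 1 N (λ i → + l i)                              ≡⟨ sym (∑-cong′ 1 N (λ i → ∑-one 1 (l i))) ⟩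
    ∑ 1 N (λ i → ∑ 1 (l i) (λ _ → + 1))              ≡⟨ sym (∑-rows-extend (λ _ _ → + 1)) ⟩
    ∑ 1 (length μ) (λ i → ∑ 1 (l i) (λ _ → + 1))     ≡⟨ sym (sumℤ-map-cells (λ _ → + 1) μ) ⟩
    sumℤ (map (λ _ → + 1) (cells μ))       ∎

  size≡∑l : + size μ ≡ ∑ 1 N (λ i → + l i)
  size≡∑l = trans (size≡∑part μ) (∑-extend 1 (length μ) N _ len≤2n λ i len<i → cong +_ (part-beyond-length μ len<i))

  b-conj≡ : EmptyTwoCore μ → b (conj μ) ≡ + ⌊ size μ /2⌋ - + (n ℕ.* n) - + n + ∑ 1 N pairRow
  b-conj≡ tiled@(D , tiling) = begin
    b (conj μ)                                               ≡⟨ b-conj≡∑conjRow ⟩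
    ∑ 1 N conjRow                                            ≡⟨ ∑-conjRow n (length D) refl (∑g≡0 tiled) ∑l≡2|D| ⟩
    + length D - + (n ℕ.* n) - + n + ∑ 1 N pairRow
      ≡⟨ cong (λ d → + d - + (n ℕ.* n) - + n + ∑ 1 N pairRow) (sym |μ|/2≡|D|) ⟩
    + ⌊ size μ /2⌋ - + (n ℕ.* n) - + n + ∑ 1 N pairRow       ∎
    where
    ∑l≡2|D| : ∑ 1 N (λ i → + l i) ≡ + 2 * + length D
    ∑l≡2|D| = trans ∑l≡cells (tiled-size μ D tiling)
    |μ|/2≡|D| : ⌊ size μ /2⌋ ≡ length D
    |μ|/2≡|D| = half-double (size μ) (length D) (ℤ.+-injective (trans size≡∑l (trans ∑l≡2|D| (sym (ℤ.pos-* 2 (length D))))))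

lemma2p3 : (n : ℕ) (μ : List ℕ) → IsPartition μ → length μ ≤ 2 ℕ.* n →
    (b μ ≡ Σ[ 1 ⋯ 2 ℕ.* n ] (λ i → Σ[ 1 ⋯ part μ i ℕ.+ (2 ℕ.* n ℕ.∸ i) ] (λ j →
              sgn (+ part μ i - + i - + j + + 1) * (+ part μ i - + i)))
           - Σ[ 1 ⋯ 2 ℕ.* n ] (λ i → Σ[ ℕ.suc i ⋯ 2 ℕ.* n ] (λ j →
              sgn (+ part μ i - + part μ j + + j - + i) * (+ part μ i - + i))))
    × (EmptyTwoCore μ →
       b (conj μ) ≡ + ⌊ size μ /2⌋ - + (n ℕ.* n) - + n
           + Σ[ 1 ⋯ 2 ℕ.* n ] (λ i → Σ[ ℕ.suc i ⋯ 2 ℕ.* n ] (λ j →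
              sgn (+ part μ i - + part μ j + + j - + i) * (+ part μ j - + j))))
lemma2p3 n μ (μ↓ , _) len≤2n =
  trans b≡∑δ-cells-∑pairs
        (sym (cong₂ _-_ (ΣΣ≡∑∑ 1 N (λ _ → 1) (λ i → l i ℕ.+ (N ∸ i)) δ-cell) (ΣΣ≡∑∑ 1 N suc (λ _ → N) pair))) ,
  λ tiled → trans (b-conj≡ tiled)
                  (cong (_+_ (+ ⌊ size μ /2⌋ - + (n ℕ.* n) - + n)) (sym (ΣΣ≡∑∑ 1 N suc (λ _ → N) pair′)))
  where
  open Statistic n μ↓ len≤2n
  δ-cell pair pair′ : ℕ → ℕ → ℤ
  δ-cell i j = sgn (+ l i - + i - + j + + 1) * (+ l i - + i)
  pair   i j = sgn (+ l i - + l j + + j - + i) * (+ l i - + i)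
  pair′  i j = sgn (+ l i - + l j + + j - + i) * (+ l j - + j)
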